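{- Let $\mathbb{F}$ be a field and let $n\ge d\ge 1$ with $|\mathbb{F}|\ge n$. Then the monomial set of the elementary symmetric polynomial $S_n^d$ is expressible as a read-once determinant: there exists a matrix $M$ with entries in $\{x_1,\ldots,x_n\}\cup\mathbb{F}$, in which each variable $x_i$ occurs in at most one position, such that $mon(\det(M))=mon(S_n^d)$.
   Context: $S_n^d(x_1,\ldots,x_n)=\sum_{A\subseteq\{1,\ldots,n\},|A|=d}\prod_{i\in A}x_i$. For a polynomial $f\in\mathbb{F}[x_1,\ldots,x_n]$, $mon(f)$ denotes the set of monomials having nonzero coefficient in $f$. -}

module Defs where

open import Level using (Level; _⊔_)
open import Algebra.Bundles using (CommutativeRing)
open import Data.Nat as ℕ using (ℕ; zero; suc; _∸_)
open import Data.Bool using (Bool; true; false; if_then_else_)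
open import Data.Fin as Fin using (Fin; zero; suc; punchIn)
open import Data.Vec using (Vec; []; _∷_; zipWith; replicate; lookup; count)
open import Data.Vec.Properties using (≡-dec)
open import Data.List as List using (List; []; _∷_; map; concatMap; upTo; filter; foldr)
open import Data.Product using (Σ; _×_; _,_)
open import Relation.Nullary using (¬_; yes; no)
open import Relation.Binary.PropositionalEquality using (_≡_)

record Field (c ℓ : Level) : Set (Level.suc (c ⊔ ℓ)) where
  field
    commutativeRing : CommutativeRing c ℓ
  open CommutativeRing commutativeRing public
  field
    1≉0     : ¬ (1# ≈ 0#)
    inverse : ∀ x → ¬ (x ≈ 0#) → Σ Carrier λ y → (x * y) ≈ 1#

evenᵇ : ℕ → Bool
evenᵇ zero = true
evenᵇ (suc zero) = false
evenᵇ (suc (suc k)) = evenᵇ k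

Monomial : ℕ → Set
Monomial n = Vec ℕ n

below : ∀ {n} → Monomial n → List (Monomial n)
below []      = [] ∷ []
below (k ∷ m) = concatMap (λ a → map (a ∷_) (below m)) (upTo (suc k))

unitMon : ∀ {n} → Fin n → Monomial n
unitMon {suc n} zero    = 1 ∷ replicate n 0
unitMon {suc n} (suc i) = 0 ∷ unitMon i

module PolyRing {c ℓ} (F : Field c ℓ) where
  open Field F using (Carrier; _≈_; _+_; _*_; -_; 0#; 1#)

  Poly : ℕ → Set c
  Poly n = Monomial n → Carrier

  ΣF : ∀ {a} {A : Set a} → List A → (A → Carrier) → Carrier
  ΣF xs f = foldr (λ a s → f a + s) 0# xs

  const : ∀ {n} → Carrier → Poly n
  const {n} k m with ≡-dec ℕ._≟_ m (replicate n 0)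
  ... | yes _ = k
  ... | no  _ = 0#

  X : ∀ {n} → Fin n → Poly n
  X i m with ≡-dec ℕ._≟_ m (unitMon i)
  ... | yes _ = 1#
  ... | no  _ = 0#

  _+P_ : ∀ {n} → Poly n → Poly n → Poly n
  (p +P q) m = p m + q m

  -P_ : ∀ {n} → Poly n → Poly n
  (-P p) m = - p m

  _*P_ : ∀ {n} → Poly n → Poly n → Poly n
  (p *P q) m = ΣF (below m) (λ a → p a * q (zipWith _∸_ m a))

  0P 1P : ∀ {n} → Poly n
  0P = const 0#
  1P = const 1#

  ΣP : ∀ {n a} {A : Set a} → List A → (A → Poly n) → Poly n
  ΣP xs f = foldr (λ a s → f a +P s) 0P xs

  ΠP : ∀ {n a} {A : Set a} → List A → (A → Poly n) → Poly n
  ΠP xs f = foldr (λ a s → f a *P s) 1P xs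

  _∈mon_ : ∀ {n} → Monomial n → Poly n → Set ℓ
  m ∈mon f = ¬ (f m ≈ 0#)

  subsets : (n : ℕ) → List (Vec Bool n)
  subsets zero    = [] ∷ []
  subsets (suc n) = map (true ∷_) (subsets n) List.++ map (false ∷_) (subsets n)

  size : ∀ {n} → Vec Bool n → ℕ
  size []          = 0
  size (true ∷ A)  = suc (size A)
  size (false ∷ A) = size A

  prodVars : ∀ {n} → Vec Bool n → Poly n
  prodVars {n} A = ΠP (List.allFin n) (λ i → if lookup A i then X i else 1P)

  S : (n d : ℕ) → Poly n
  S n d = ΣP (subsets n) (λ A → if (size A ℕ.≡ᵇ d) then prodVars A else 0P)

  det : ∀ {n k} → (Fin k → Fin k → Poly n) → Poly n
  det {n} {zero}  M = 1P
  det {n} {suc k} M =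
    ΣP (List.allFin (suc k)) λ j →
      sign j (M zero j *P det (λ r s → M (suc r) (punchIn j s)))
    where
    sign : Fin (suc k) → Poly n → Poly n
    sign j p = if evenᵇ (Fin.toℕ j) then p else -P p

  data Entry (n : ℕ) : Set c where
    var : Fin n → Entry n
    cst : Carrier → Entry n

  ⟦_⟧ : ∀ {n} → Entry n → Poly n
  ⟦ var i ⟧ = X i
  ⟦ cst a ⟧ = const a

  ReadOnce : ∀ {n k} → (Fin k → Fin k → Entry n) → Set c
  ReadOnce M = ∀ r s r' s' i → M r s ≡ var i → M r' s' ≡ var i → (r ≡ r') × (s ≡ s')

module Submission where

open import Defs
open import Level using (_⊔_)
open import Data.Nat as ℕ using (ℕ; zero; suc; _<_; _≤_; z≤n; s≤s; _∸_)
import Data.Nat.Properties as ℕP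
import Data.Nat.Tactic.RingSolver as ℕSolver
open import Data.Bool using (Bool; true; false; if_then_else_; not)
open import Data.Empty using (⊥; ⊥-elim)
open import Data.Product using (Σ; _×_; _,_; proj₁; proj₂)
open import Data.Sum using (_⊎_; inj₁; inj₂)
open import Data.Vec using (Vec; []; _∷_; zipWith; replicate; lookup)
open import Data.Vec.Properties using (≡-dec; ∷-injectiveˡ; ∷-injectiveʳ; lookup-replicate)
open import Data.List using (List; []; _∷_; map; concatMap; upTo; applyUpTo; tabulate; allFin; _++_)
open import Data.Fin as Fin using (Fin; toℕ; punchIn; _↑ˡ_)
import Data.Fin.Properties as FP
open import Function.Bundles using (_⇔_; mk⇔; Equivalence)
import Function.Properties.Equivalence as ⇔
open import Relation.Nullary using (¬_; yes; no; Dec)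
open import Relation.Binary using (tri<; tri≈; tri>)
open import Relation.Binary.PropositionalEquality as P using (_≡_; _≢_)
open import Algebra.Bundles using (Semiring)

-- Write M = [[D, V], [W, 0]] with D = diag(x₁,…,xₙ), V the n × (n−d) Vandermonde matrix
-- (a_i^j) and W = Vᵀ, the aᵢ being n distinct field elements.  Every variable sits alone in
-- its row and column, so det M is multilinear and the coefficient of x_A (A ⊆ [n]) is, up to
-- sign, the determinant of M with the rows and columns of A deleted and the remaining xᵢ set
-- to 0.  That matrix is [[0, V'], [W', 0]] with n − |A| rows in V'; it is singular unless its
-- two zero blocks are square, i.e. |A| = d, in which case its determinant is ± det V' · det W'
-- for a square Vandermonde V' on distinct nodes, hence nonzero.

evenᵇ-suc : ∀ n → evenᵇ (suc n) ≡ not (evenᵇ n)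
evenᵇ-suc zero = P.refl
evenᵇ-suc (suc n) rewrite evenᵇ-suc n with evenᵇ n
... | true = P.refl
... | false = P.refl

ltb : ℕ → ℕ → Bool
ltb _ zero = false
ltb zero (suc n) = true
ltb (suc m) (suc n) = ltb m n

ltb-true : ∀ {m n} → m < n → ltb m n ≡ true
ltb-true {zero} {suc n} _ = P.refl
ltb-true {suc m} {suc n} (s≤s p) = ltb-true p

ltb-false : ∀ {m n} → n ≤ m → ltb m n ≡ false
ltb-false {m} {zero} _ = P.refl
ltb-false {suc m} {suc n} (s≤s p) = ltb-false p

ltb⇒< : ∀ {m n} → ltb m n ≡ true → m < n
ltb⇒< {zero} {suc n} _ = s≤s z≤n
ltb⇒< {suc m} {suc n} e = s≤s (ltb⇒< e)

ltb-suc : ∀ s t → s ≢ t → ltb s t ≡ ltb s (suc t)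
ltb-suc s t ne with ℕP.<-cmp s t
... | tri< p _ _ = P.trans (ltb-true p) (P.sym (ltb-true (ℕP.≤-trans p (ℕP.n≤1+n t))))
... | tri≈ _ e _ = ⊥-elim (ne e)
... | tri> _ _ p = P.trans (ltb-false (ℕP.<⇒≤ p)) (P.sym (ltb-false p))

ltb0-false : ∀ {x} → ltb 0 x ≡ false → x ≡ 0
ltb0-false {zero} _ = P.refl

eqb : ℕ → ℕ → Bool
eqb zero zero = true
eqb zero (suc n) = false
eqb (suc m) zero = false
eqb (suc m) (suc n) = eqb m n

eqb-refl : ∀ n → eqb n n ≡ true
eqb-refl zero = P.refl
eqb-refl (suc n) = eqb-refl n

eqb-false : ∀ {m n} → m ≢ n → eqb m n ≡ false
eqb-false {zero} {zero} ne = ⊥-elim (ne P.refl)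
eqb-false {zero} {suc n} ne = P.refl
eqb-false {suc m} {zero} ne = P.refl
eqb-false {suc m} {suc n} ne = eqb-false (λ e → ne (P.cong suc e))

eqb⇒≡ : ∀ {m n} → eqb m n ≡ true → m ≡ n
eqb⇒≡ {zero} {zero} _ = P.refl
eqb⇒≡ {suc m} {suc n} e = P.cong suc (eqb⇒≡ e)

punchInℕ : ℕ → ℕ → ℕ
punchInℕ zero c = suc c
punchInℕ (suc j) zero = zero
punchInℕ (suc j) (suc c) = suc (punchInℕ j c)

punchInℕ-≤ : ∀ j c → punchInℕ j c ≤ suc c
punchInℕ-≤ zero c = ℕP.≤-refl
punchInℕ-≤ (suc j) zero = z≤n
punchInℕ-≤ (suc j) (suc c) = s≤s (punchInℕ-≤ j c)

punchInℕ-< : ∀ {k} j c → c < k → punchInℕ j c < suc k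
punchInℕ-< j c p = s≤s (ℕP.≤-trans (punchInℕ-≤ j c) p)

punchInℕ-≢ : ∀ j c → punchInℕ j c ≢ j
punchInℕ-≢ zero c ()
punchInℕ-≢ (suc j) zero ()
punchInℕ-≢ (suc j) (suc c) e = punchInℕ-≢ j c (ℕP.suc-injective e)

punchInℕ-injective : ∀ j c d → punchInℕ j c ≡ punchInℕ j d → c ≡ d
punchInℕ-injective zero c d e = ℕP.suc-injective e
punchInℕ-injective (suc j) zero zero e = P.refl
punchInℕ-injective (suc j) (suc c) (suc d) e = P.cong suc (punchInℕ-injective j c d (ℕP.suc-injective e))

punchInℕ-below : ∀ j c → c < j → punchInℕ j c ≡ c
punchInℕ-below (suc j) zero p = P.refl
punchInℕ-below (suc j) (suc c) (s≤s p) = P.cong suc (punchInℕ-below j c p)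

punchInℕ-above : ∀ j c → j ≤ c → punchInℕ j c ≡ suc c
punchInℕ-above zero c p = P.refl
punchInℕ-above (suc j) (suc c) (s≤s p) = P.cong suc (punchInℕ-above j c p)

punchInℕ-surjective : ∀ j l k → l < suc k → j < suc k → l ≢ j → Σ ℕ λ s → punchInℕ j s ≡ l × s < k
punchInℕ-surjective zero zero k _ _ ne = ⊥-elim (ne P.refl)
punchInℕ-surjective zero (suc l) k (s≤s p) _ ne = l , P.refl , p
punchInℕ-surjective (suc j) zero (suc k) _ _ ne = zero , P.refl , s≤s z≤n
punchInℕ-surjective (suc j) zero zero _ (s≤s ()) ne
punchInℕ-surjective (suc j) (suc l) (suc k) (s≤s p) (s≤s q) ne
  with punchInℕ-surjective j l k p q (λ e → ne (P.cong suc e))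
... | s , e , b = suc s , P.cong suc e , s≤s b

punchInℕ-adjacent : ∀ j s → (punchInℕ j s ≡ punchInℕ (suc j) s) ⊎ (s ≡ j)
punchInℕ-adjacent zero zero = inj₂ P.refl
punchInℕ-adjacent zero (suc s) = inj₁ P.refl
punchInℕ-adjacent (suc j) zero = inj₁ P.refl
punchInℕ-adjacent (suc j) (suc s) with punchInℕ-adjacent j s
... | inj₁ e = inj₁ (P.cong suc e)
... | inj₂ e = inj₂ (P.cong suc e)

punchInℕ-punchInℕ : ∀ a b s → a ≤ b → punchInℕ a (punchInℕ b s) ≡ punchInℕ (suc b) (punchInℕ a s)
punchInℕ-punchInℕ zero b s p = P.refl
punchInℕ-punchInℕ (suc a) (suc b) zero p = P.refl
punchInℕ-punchInℕ (suc a) (suc b) (suc s) (s≤s p) = P.cong suc (punchInℕ-punchInℕ a b s p)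

punchInℕ-+ : ∀ a j s → a ≤ s → punchInℕ (a ℕ.+ j) s ≡ a ℕ.+ punchInℕ j (s ∸ a)
punchInℕ-+ zero j s _ = P.refl
punchInℕ-+ (suc a) j (suc s) (s≤s p) = P.cong suc (punchInℕ-+ a j s p)

ltb-punchInℕ : ∀ i n x → i ≤ n → ltb (punchInℕ i x) (suc n) ≡ ltb x n
ltb-punchInℕ zero n x _ = P.refl
ltb-punchInℕ (suc i) (suc n) zero _ = P.refl
ltb-punchInℕ (suc i) (suc n) (suc x) (s≤s p) = ltb-punchInℕ i n x p

∸-punchInℕ : ∀ i n x → i ≤ n → n ≤ x → punchInℕ i x ∸ suc n ≡ x ∸ n
∸-punchInℕ i n x p q rewrite punchInℕ-above i x (ℕP.≤-trans p q) = P.refl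

eqb-punchInℕ : ∀ i x y → eqb (punchInℕ i x) (punchInℕ i y) ≡ eqb x y
eqb-punchInℕ zero x y = P.refl
eqb-punchInℕ (suc i) zero zero = P.refl
eqb-punchInℕ (suc i) zero (suc y) = P.refl
eqb-punchInℕ (suc i) (suc x) zero = P.refl
eqb-punchInℕ (suc i) (suc x) (suc y) = eqb-punchInℕ i x y

toℕ-punchIn : ∀ {k} (j : Fin (suc k)) (s : Fin k) → toℕ (punchIn j s) ≡ punchInℕ (toℕ j) (toℕ s)
toℕ-punchIn Fin.zero s = P.refl
toℕ-punchIn (Fin.suc j) Fin.zero = P.refl
toℕ-punchIn (Fin.suc j) (Fin.suc s) = P.cong suc (toℕ-punchIn j s)

-- Deleting column l and then column j' of the minor is the same as deleting column
-- punchInℕ l j' and then column l'; the two index sums differ by an odd number.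
punchInℕ-exchange : ∀ l j' → Σ ℕ λ l' →
  (punchInℕ (punchInℕ l j') l' ≡ l) ×
  (∀ s → punchInℕ (punchInℕ l j') (punchInℕ l' s) ≡ punchInℕ l (punchInℕ j' s)) ×
  ((punchInℕ l j' ℕ.+ l' ≡ suc (l ℕ.+ j')) ⊎ (suc (suc (punchInℕ l j' ℕ.+ l')) ≡ suc (l ℕ.+ j')))
punchInℕ-exchange l j' with ℕP.<-cmp j' l
punchInℕ-exchange (suc l) j' | tri< (s≤s j'≤l) _ _ rewrite punchInℕ-below (suc l) j' (s≤s j'≤l) =
  l , punchInℕ-above j' l j'≤l , (λ s → punchInℕ-punchInℕ j' l s j'≤l) ,
  inj₂ (P.cong (λ z → suc (suc z)) (ℕP.+-comm j' l))
punchInℕ-exchange l j' | tri≈ _ P.refl _ rewrite punchInℕ-above l l ℕP.≤-refl =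
  l , punchInℕ-below (suc l) l ℕP.≤-refl , (λ s → P.sym (punchInℕ-punchInℕ l l s ℕP.≤-refl)) ,
  inj₁ (P.cong suc (ℕP.+-comm l l))
punchInℕ-exchange l j' | tri> _ _ l<j' rewrite punchInℕ-above l j' (ℕP.<⇒≤ l<j') =
  l , punchInℕ-below (suc j') l (ℕP.≤-trans l<j' (ℕP.n≤1+n j')) ,
  (λ s → P.sym (punchInℕ-punchInℕ l j' s (ℕP.<⇒≤ l<j'))) ,
  inj₁ (P.cong suc (ℕP.+-comm j' l))

boolToℕ : Bool → ℕ
boolToℕ true = 1
boolToℕ false = 0

count< : ℕ → (ℕ → Bool) → ℕ
count< zero p = 0
count< (suc k) p = boolToℕ (p 0) ℕ.+ count< k (λ i → p (suc i))

count<-extract : ∀ k l → l ≤ k → (p : ℕ → Bool) →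
                 count< (suc k) p ≡ boolToℕ (p l) ℕ.+ count< k (λ j → p (punchInℕ l j))
count<-extract k zero _ p = P.refl
count<-extract (suc k) (suc l) (s≤s q) p =
  P.trans (P.cong (boolToℕ (p 0) ℕ.+_) (count<-extract k l q (λ i → p (suc i))))
          (swap (boolToℕ (p 0)) (boolToℕ (p (suc l))) (count< k (λ j → p (suc (punchInℕ l j)))))
  where
  swap : ∀ a b c → a ℕ.+ (b ℕ.+ c) ≡ b ℕ.+ (a ℕ.+ c)
  swap = ℕSolver.solve-∀

count<-all : ∀ n (p : ℕ → Bool) → (∀ i → i < n → p i ≡ true) → count< n p ≡ n
count<-all zero p h = P.refl
count<-all (suc n) p h rewrite h 0 (s≤s z≤n) = P.cong suc (count<-all n (λ i → p (suc i)) (λ i q → h (suc i) (s≤s q)))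

count<-none : ∀ n (p : ℕ → Bool) → (∀ i → i < n → p i ≡ false) → count< n p ≡ 0
count<-none zero p h = P.refl
count<-none (suc n) p h rewrite h 0 (s≤s z≤n) = count<-none n (λ i → p (suc i)) (λ i q → h (suc i) (s≤s q))

count<-ltb : ∀ n r → count< (n ℕ.+ r) (λ j → ltb j n) ≡ n
count<-ltb zero r = count<-none r _ (λ i _ → P.refl)
count<-ltb (suc n) r = P.cong suc (count<-ltb n r)

count<-not-ltb : ∀ n r → count< (n ℕ.+ r) (λ j → not (ltb j n)) ≡ r
count<-not-ltb zero r = count<-all r _ (λ i _ → P.refl)
count<-not-ltb (suc n) r = count<-not-ltb n r

count<-not+count< : ∀ k (p : ℕ → Bool) → count< k (λ x → not (p x)) ℕ.+ count< k p ≡ k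
count<-not+count< zero p = P.refl
count<-not+count< (suc k) p with p 0
... | true = P.trans (ℕP.+-suc _ _) (P.cong suc (count<-not+count< k (λ i → p (suc i))))
... | false = P.cong suc (count<-not+count< k (λ i → p (suc i)))

findTrue : ∀ n (A : ℕ → Bool) → (Σ ℕ λ i → i < n × A i ≡ true) ⊎ (∀ i → i < n → A i ≡ false)
findTrue zero A = inj₂ (λ i ())
findTrue (suc n) A with A 0 in e
... | true = inj₁ (0 , s≤s z≤n , e)
... | false with findTrue n (λ i → A (suc i))
...   | inj₁ (i , p , q) = inj₁ (suc i , s≤s p , q)
...   | inj₂ h = inj₂ λ { zero _ → e ; (suc i) (s≤s p) → h i p }

<⇒≤pred : ∀ {j c} → j < c → Σ ℕ λ c' → (c ≡ suc c') × (j ≤ c')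
<⇒≤pred {c = suc c'} (s≤s p) = c' , P.refl , p

lookupℕ : ∀ {n} → Vec ℕ n → ℕ → ℕ
lookupℕ [] _ = 0
lookupℕ (x ∷ m) zero = x
lookupℕ (x ∷ m) (suc i) = lookupℕ m i

lookupℕ-toℕ : ∀ {n} (m : Vec ℕ n) i → lookupℕ m (toℕ i) ≡ lookup m i
lookupℕ-toℕ (x ∷ m) Fin.zero = P.refl
lookupℕ-toℕ (x ∷ m) (Fin.suc i) = lookupℕ-toℕ m i

Squarefree : ∀ {n} → Monomial n → Set
Squarefree m = ∀ i → lookup m i ≤ 1

support : ∀ {n} → Monomial n → ℕ → Bool
support m x = eqb (lookupℕ m x) 1

ltb0≡eqb1 : ∀ {v} → v ≤ 1 → ltb 0 v ≡ eqb v 1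
ltb0≡eqb1 {zero} _ = P.refl
ltb0≡eqb1 {suc zero} _ = P.refl
ltb0≡eqb1 {suc (suc v)} (s≤s ())

weight : ∀ {n} → Monomial n → ℕ
weight [] = 0
weight (x ∷ m) = boolToℕ (eqb x 1) ℕ.+ weight m

count<-support : ∀ {n} (m : Monomial n) → count< n (support m) ≡ weight m
count<-support [] = P.refl
count<-support (x ∷ m) = P.cong (boolToℕ (eqb x 1) ℕ.+_) (count<-support m)

isSubsetOfSize : ∀ {n} → ℕ → Vec ℕ n → Bool
isSubsetOfSize d [] = eqb d 0
isSubsetOfSize d (zero ∷ m) = isSubsetOfSize d m
isSubsetOfSize zero (suc zero ∷ m) = false
isSubsetOfSize (suc d) (suc zero ∷ m) = isSubsetOfSize d m
isSubsetOfSize d (suc (suc x) ∷ m) = false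

isSubsetOfSize-nonSquarefree : ∀ {n} d (m : Monomial n) (i : Fin n) → 2 ≤ lookup m i → isSubsetOfSize d m ≡ false
isSubsetOfSize-nonSquarefree zero (suc (suc x) ∷ m) Fin.zero _ = P.refl
isSubsetOfSize-nonSquarefree (suc d) (suc (suc x) ∷ m) Fin.zero _ = P.refl
isSubsetOfSize-nonSquarefree zero (suc zero ∷ m) Fin.zero (s≤s ())
isSubsetOfSize-nonSquarefree (suc d) (suc zero ∷ m) Fin.zero (s≤s ())
isSubsetOfSize-nonSquarefree d (zero ∷ m) (Fin.suc i) p = isSubsetOfSize-nonSquarefree d m i p
isSubsetOfSize-nonSquarefree zero (suc zero ∷ m) (Fin.suc i) p = P.refl
isSubsetOfSize-nonSquarefree (suc d) (suc zero ∷ m) (Fin.suc i) p = isSubsetOfSize-nonSquarefree d m i p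
isSubsetOfSize-nonSquarefree zero (suc (suc x) ∷ m) (Fin.suc i) p = P.refl
isSubsetOfSize-nonSquarefree (suc d) (suc (suc x) ∷ m) (Fin.suc i) p = P.refl

isSubsetOfSize-sound : ∀ {n} d (m : Monomial n) → Squarefree m → isSubsetOfSize d m ≡ true → weight m ≡ d
isSubsetOfSize-sound zero [] h e = P.refl
isSubsetOfSize-sound (suc d) [] h ()
isSubsetOfSize-sound d (zero ∷ m) h e = isSubsetOfSize-sound d m (λ i → h (Fin.suc i)) e
isSubsetOfSize-sound zero (suc zero ∷ m) h ()
isSubsetOfSize-sound (suc d) (suc zero ∷ m) h e = P.cong suc (isSubsetOfSize-sound d m (λ i → h (Fin.suc i)) e)
isSubsetOfSize-sound d (suc (suc x) ∷ m) h e with h Fin.zero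
... | s≤s ()

isSubsetOfSize-complete : ∀ {n} d (m : Monomial n) → Squarefree m → weight m ≡ d → isSubsetOfSize d m ≡ true
isSubsetOfSize-complete zero [] h e = P.refl
isSubsetOfSize-complete d (zero ∷ m) h e = isSubsetOfSize-complete d m (λ i → h (Fin.suc i)) e
isSubsetOfSize-complete zero (suc zero ∷ m) h ()
isSubsetOfSize-complete (suc d) (suc zero ∷ m) h e = isSubsetOfSize-complete d m (λ i → h (Fin.suc i)) (ℕP.suc-injective e)
isSubsetOfSize-complete d (suc (suc x) ∷ m) h e with h Fin.zero
... | s≤s ()

complement≡n∸d⇔weight≡d : ∀ {n} d (m : Monomial n) → d ≤ n →
                          (count< n (λ x → not (support m x)) ≡ n ∸ d) ⇔ (weight m ≡ d)
complement≡n∸d⇔weight≡d {n} d m d≤n = mk⇔ to from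
  where
  total : count< n (λ x → not (support m x)) ℕ.+ count< n (support m) ≡ n
  total = count<-not+count< n (support m)
  to : count< n (λ x → not (support m x)) ≡ n ∸ d → weight m ≡ d
  to e = P.trans (P.sym (count<-support m))
           (P.trans (P.sym (ℕP.m+n∸m≡n (count< n (λ x → not (support m x))) (count< n (support m))))
                    (P.trans (P.cong₂ _∸_ total e) (ℕP.m∸[m∸n]≡n d≤n)))
  from : weight m ≡ d → count< n (λ x → not (support m x)) ≡ n ∸ d
  from e = P.trans (P.sym (ℕP.m+n∸n≡m (count< n (λ x → not (support m x))) (count< n (support m))))
                   (P.cong₂ _∸_ total (P.trans (count<-support m) e))

squarefree? : ∀ {n} (m : Monomial n) → (Σ (Fin n) λ i → 2 ≤ lookup m i) ⊎ Squarefree m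
squarefree? [] = inj₂ (λ ())
squarefree? (x ∷ m) with x ℕP.≤? 1 | squarefree? m
... | no x≰1 | _ = inj₁ (Fin.zero , ℕP.≰⇒> x≰1)
... | yes _ | inj₁ (i , p) = inj₁ (Fin.suc i , p)
... | yes x≤1 | inj₂ h = inj₂ λ { Fin.zero → x≤1 ; (Fin.suc i) → h i }

ltb0⇒1≤ : ∀ {x} → ltb 0 x ≡ true → 1 ≤ x
ltb0⇒1≤ {suc x} _ = s≤s z≤n

ltb0∧≤1⇒≡1 : ∀ {x} → ltb 0 x ≡ true → x ≤ 1 → x ≡ 1
ltb0∧≤1⇒≡1 {suc zero} _ _ = P.refl
ltb0∧≤1⇒≡1 {suc (suc x)} _ (s≤s ())

≤1∧≢1⇒≡0 : ∀ {x} → x ≤ 1 → x ≢ 1 → x ≡ 0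
≤1∧≢1⇒≡0 {zero} _ _ = P.refl
≤1∧≢1⇒≡0 {suc zero} _ ne = ⊥-elim (ne P.refl)
≤1∧≢1⇒≡0 {suc (suc x)} (s≤s ()) _

anyᶠ : ∀ {k} → (Fin k → Bool) → Bool
anyᶠ {zero} f = false
anyᶠ {suc k} f = if f Fin.zero then true else anyᶠ (λ s → f (Fin.suc s))

anyᶠ-punchIn : ∀ {k} (f : Fin (suc k) → Bool) j → anyᶠ f ≡ (if f j then true else anyᶠ (λ s → f (punchIn j s)))
anyᶠ-punchIn f Fin.zero = P.refl
anyᶠ-punchIn {suc k} f (Fin.suc j) rewrite anyᶠ-punchIn (λ s → f (Fin.suc s)) j with f Fin.zero | f (Fin.suc j)
... | true | true = P.refl
... | true | false = P.refl
... | false | _ = P.refl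

anyᶠ-true : ∀ {k} (f : Fin (suc k) → Bool) j → f j ≡ true → anyᶠ f ≡ true
anyᶠ-true f j e rewrite anyᶠ-punchIn f j | e = P.refl

anyᶠ-false : ∀ {k} (f : Fin k → Bool) → (∀ s → f s ≡ false) → anyᶠ f ≡ false
anyᶠ-false {zero} f h = P.refl
anyᶠ-false {suc k} f h rewrite h Fin.zero = anyᶠ-false (λ s → f (Fin.suc s)) (λ s → h (Fin.suc s))

anyᶠ-cong : ∀ {k} (f g : Fin k → Bool) → (∀ s → f s ≡ g s) → anyᶠ f ≡ anyᶠ g
anyᶠ-cong {zero} f g h = P.refl
anyᶠ-cong {suc k} f g h rewrite h Fin.zero = P.cong (λ b → if g Fin.zero then true else b) (anyᶠ-cong _ _ (λ s → h (Fin.suc s)))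

anyᶠ-only : ∀ {k} (f : Fin k → Bool) j → (∀ s → s ≢ j → f s ≡ false) → anyᶠ f ≡ f j
anyᶠ-only {suc k} f j h = P.trans (anyᶠ-punchIn f j) (if-self (f j))
  where
  if-self : ∀ b → (if b then true else anyᶠ (λ s → f (punchIn j s))) ≡ b
  if-self true = P.refl
  if-self false = anyᶠ-false _ (λ s → h (punchIn j s) (FP.punchInᵢ≢i j s))

findᶠ : ∀ {k} (f : Fin k → Bool) → (Σ (Fin k) λ j → f j ≡ true) ⊎ (∀ j → f j ≡ false)
findᶠ {zero} f = inj₂ (λ ())
findᶠ {suc k} f with f Fin.zero in e
... | true = inj₁ (Fin.zero , e)
... | false with findᶠ (λ s → f (Fin.suc s))
...   | inj₁ (j , q) = inj₁ (Fin.suc j , q)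
...   | inj₂ h = inj₂ λ { Fin.zero → e ; (Fin.suc j) → h j }

module Determinant {c ℓ} (F : Field c ℓ) where
  open Field F hiding (zero)
  open import Algebra.Properties.Ring ring
    using (-‿distribˡ-*; -‿distribʳ-*; -‿involutive; -0#≈0#; -‿+-comm; +-inverseˡ-unique)
  open import Algebra.Properties.CommutativeSemigroup +-commutativeSemigroup
    using () renaming (interchange to +-interchange; x∙yz≈y∙xz to +-leftComm)
  open import Algebra.Properties.CommutativeSemigroup *-commutativeSemigroup
    using () renaming (interchange to *-interchange; x∙yz≈y∙xz to *-leftComm)
  open import Algebra.Definitions.RawSemiring (Semiring.rawSemiring semiring) using (_^_)
  open import Relation.Binary.Reasoning.Setoid setoid

  -- Sums over i < k.  Opaque, so that unification never unfolds a sum of unknown length.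
  opaque
    Σ< : ℕ → (ℕ → Carrier) → Carrier
    Σ< zero f = 0#
    Σ< (suc k) f = f 0 + Σ< k (λ i → f (suc i))

    Σ<-zero : ∀ {f : ℕ → Carrier} → Σ< 0 f ≡ 0#
    Σ<-zero = P.refl

    Σ<-suc : ∀ {k} {f : ℕ → Carrier} → Σ< (suc k) f ≡ (f 0 + Σ< k (λ i → f (suc i)))
    Σ<-suc = P.refl

    Σ<-cong : ∀ k {f g : ℕ → Carrier} → (∀ i → i < k → f i ≈ g i) → Σ< k f ≈ Σ< k g
    Σ<-cong zero h = refl
    Σ<-cong (suc k) h = +-cong (h 0 (s≤s z≤n)) (Σ<-cong k (λ i p → h (suc i) (s≤s p)))

    Σ<-≈0 : ∀ k {f : ℕ → Carrier} → (∀ i → i < k → f i ≈ 0#) → Σ< k f ≈ 0#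
    Σ<-≈0 zero h = refl
    Σ<-≈0 (suc k) h = trans (+-cong (h 0 (s≤s z≤n)) (Σ<-≈0 k (λ i p → h (suc i) (s≤s p)))) (+-identityˡ 0#)

    Σ<-+ : ∀ k (f g : ℕ → Carrier) → Σ< k (λ i → f i + g i) ≈ (Σ< k f + Σ< k g)
    Σ<-+ zero f g = sym (+-identityˡ 0#)
    Σ<-+ (suc k) f g = trans (+-congˡ (Σ<-+ k (λ i → f (suc i)) (λ i → g (suc i)))) (+-interchange _ _ _ _)

    Σ<-*ˡ : ∀ k a (f : ℕ → Carrier) → (a * Σ< k f) ≈ Σ< k (λ i → a * f i)
    Σ<-*ˡ zero a f = zeroʳ a
    Σ<-*ˡ (suc k) a f = trans (distribˡ a _ _) (+-congˡ (Σ<-*ˡ k a (λ i → f (suc i))))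

    Σ<-neg : ∀ k (f : ℕ → Carrier) → (- Σ< k f) ≈ Σ< k (λ i → - f i)
    Σ<-neg zero f = -0#≈0#
    Σ<-neg (suc k) f = trans (sym (-‿+-comm _ _)) (+-congˡ (Σ<-neg k (λ i → f (suc i))))

    Σ<-swap : ∀ a b (f : ℕ → ℕ → Carrier) → Σ< a (λ i → Σ< b (λ j → f i j)) ≈ Σ< b (λ j → Σ< a (λ i → f i j))
    Σ<-swap zero b f = sym (Σ<-≈0 b (λ _ _ → refl))
    Σ<-swap (suc a) b f =
      trans (+-congˡ (Σ<-swap a b (λ i j → f (suc i) j))) (sym (Σ<-+ b (λ j → f 0 j) (λ j → Σ< a (λ i → f (suc i) j))))

    Σ<-split : ∀ a b (f : ℕ → Carrier) → Σ< (a ℕ.+ b) f ≈ (Σ< a f + Σ< b (λ j → f (a ℕ.+ j)))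
    Σ<-split zero b f = sym (+-identityˡ _)
    Σ<-split (suc a) b f = trans (+-congˡ (Σ<-split a b (λ i → f (suc i)))) (sym (+-assoc _ _ _))

    Σ<-extract : ∀ k l → l ≤ k → (f : ℕ → Carrier) → Σ< (suc k) f ≈ (f l + Σ< k (λ j → f (punchInℕ l j)))
    Σ<-extract k zero p f = refl
    Σ<-extract (suc k) (suc l) (s≤s p) f = trans (+-congˡ (Σ<-extract k l p (λ i → f (suc i)))) (+-leftComm _ _ _)

    Σ<-single : ∀ k l → l < k → (f : ℕ → Carrier) → (∀ i → i < k → i ≢ l → f i ≈ 0#) → Σ< k f ≈ f l
    Σ<-single (suc k) l (s≤s p) f h = trans (Σ<-extract k l p f)
       (trans (+-congˡ (Σ<-≈0 k (λ j q → h (punchInℕ l j) (punchInℕ-< l j q) (punchInℕ-≢ l j)))) (+-identityʳ _))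

    Σ<-pair : ∀ k l → suc l < k → (f : ℕ → Carrier) → (∀ i → i < k → i ≢ l → i ≢ suc l → f i ≈ 0#) →
              (f l + f (suc l)) ≈ 0# → Σ< k f ≈ 0#
    Σ<-pair (suc (suc k)) zero p f h e =
      trans (sym (+-assoc _ _ _))
            (trans (+-cong e (Σ<-≈0 k (λ i pi → h (suc (suc i)) (s≤s (s≤s pi)) (λ ()) (λ ())))) (+-identityˡ 0#))
    Σ<-pair (suc k) (suc l) (s≤s p) f h e =
      trans (+-cong (h 0 (s≤s z≤n) (λ ()) (λ ()))
                    (Σ<-pair k l p (λ i → f (suc i))
                       (λ i pi n1 n2 → h (suc i) (s≤s pi) (λ q → n1 (ℕP.suc-injective q)) (λ q → n2 (ℕP.suc-injective q))) e))
            (+-identityˡ 0#)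

  Σ<-*ʳ : ∀ k a (f : ℕ → Carrier) → (Σ< k f * a) ≈ Σ< k (λ i → f i * a)
  Σ<-*ʳ k a f = trans (*-comm _ a) (trans (Σ<-*ˡ k a f) (Σ<-cong k (λ i _ → *-comm a (f i))))

  sgn : ℕ → Carrier → Carrier
  sgn n x = if evenᵇ n then x else - x

  sgn-cong : ∀ n {x y} → x ≈ y → sgn n x ≈ sgn n y
  sgn-cong n e with evenᵇ n
  ... | true = e
  ... | false = -‿cong e

  sgn-suc : ∀ n x → sgn (suc n) x ≈ (- sgn n x)
  sgn-suc n x rewrite evenᵇ-suc n with evenᵇ n
  ... | true = refl
  ... | false = sym (-‿involutive x)

  sgn-+ : ∀ a b x → sgn (a ℕ.+ b) x ≈ sgn a (sgn b x)
  sgn-+ zero b x = refl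
  sgn-+ (suc a) b x = trans (sgn-suc (a ℕ.+ b) x) (trans (-‿cong (sgn-+ a b x)) (sym (sgn-suc a _)))

  sgn-*ˡ : ∀ n x y → (sgn n x * y) ≈ sgn n (x * y)
  sgn-*ˡ n x y with evenᵇ n
  ... | true = refl
  ... | false = sym (-‿distribˡ-* x y)

  sgn-*ʳ : ∀ n x y → (x * sgn n y) ≈ sgn n (x * y)
  sgn-*ʳ n x y with evenᵇ n
  ... | true = refl
  ... | false = sym (-‿distribʳ-* x y)

  sgn-distrib-+ : ∀ n x y → sgn n (x + y) ≈ (sgn n x + sgn n y)
  sgn-distrib-+ n x y with evenᵇ n
  ... | true = refl
  ... | false = sym (-‿+-comm x y)

  sgn-Σ< : ∀ n k (f : ℕ → Carrier) → sgn n (Σ< k f) ≈ Σ< k (λ i → sgn n (f i))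
  sgn-Σ< n k f with evenᵇ n
  ... | true = refl
  ... | false = Σ<-neg k f

  sgn-0# : ∀ n → sgn n 0# ≈ 0#
  sgn-0# n with evenᵇ n
  ... | true = refl
  ... | false = -0#≈0#

  sgn≈0⇒≈0 : ∀ n x → sgn n x ≈ 0# → x ≈ 0#
  sgn≈0⇒≈0 n x e with evenᵇ n
  ... | true = e
  ... | false = trans (sym (-‿involutive x)) (trans (-‿cong e) -0#≈0#)

  sgn-≉0 : ∀ n x → ¬ (x ≈ 0#) → ¬ (sgn n x ≈ 0#)
  sgn-≉0 n x x≉0 e = x≉0 (sgn≈0⇒≈0 n x e)

  -- Matrices are indexed by ℕ; detℕ k X only reads the entries X r s with r, s < k.
  Matrix : Set c
  Matrix = ℕ → ℕ → Carrier

  minor : ℕ → Matrix → Matrix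
  minor j X r s = X (suc r) (punchInℕ j s)

  detℕ : ℕ → Matrix → Carrier
  detℕ zero X = 1#
  detℕ (suc k) X = Σ< (suc k) (λ j → sgn j (X 0 j * detℕ k (minor j X)))

  detℕ-cong : ∀ k {X Y : Matrix} → (∀ r s → r < k → s < k → X r s ≈ Y r s) → detℕ k X ≈ detℕ k Y
  detℕ-cong zero h = refl
  detℕ-cong (suc k) h = Σ<-cong (suc k) (λ j pj → sgn-cong j (*-cong (h 0 j (s≤s z≤n) pj)
       (detℕ-cong k (λ r s pr ps → h (suc r) (punchInℕ j s) (s≤s pr) (punchInℕ-< j s ps)))))

  sgn-zeroˡ : ∀ n {a} b → a ≈ 0# → sgn n (a * b) ≈ 0#
  sgn-zeroˡ n b e = trans (sgn-cong n (trans (*-congʳ e) (zeroˡ b))) (sgn-0# n)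

  sgn-zeroʳ : ∀ n a {b} → b ≈ 0# → sgn n (a * b) ≈ 0#
  sgn-zeroʳ n a e = trans (sgn-cong n (trans (*-congˡ e) (zeroʳ a))) (sgn-0# n)

  detℕ-zeroRow : ∀ k r {X : Matrix} → r < k → (∀ s → s < k → X r s ≈ 0#) → detℕ k X ≈ 0#
  detℕ-zeroRow (suc k) zero {X} p h = Σ<-≈0 (suc k) {λ j → sgn j (X 0 j * detℕ k (minor j X))} (λ j pj → sgn-zeroˡ j _ (h j pj))
  detℕ-zeroRow (suc k) (suc r) {X} (s≤s p) h = Σ<-≈0 (suc k) {λ j → sgn j (X 0 j * detℕ k (minor j X))} (λ j pj → sgn-zeroʳ j _
       (detℕ-zeroRow k r p (λ s ps → h (punchInℕ j s) (punchInℕ-< j s ps))))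

  detℕ-additiveCol : ∀ k col → col < k → {X Y Z : Matrix} →
           (∀ r s → r < k → s < k → s ≢ col → (X r s ≈ Y r s) × (X r s ≈ Z r s)) →
           (∀ r → r < k → X r col ≈ (Y r col + Z r col)) →
           detℕ k X ≈ (detℕ k Y + detℕ k Z)
  detℕ-additiveCol (suc k) col col<k {X} {Y} {Z} off on =
    trans (Σ<-cong (suc k) term) (Σ<-+ (suc k) (λ j → sgn j (Y 0 j * detℕ k (minor j Y))) (λ j → sgn j (Z 0 j * detℕ k (minor j Z))))
    where
    term : ∀ j → j < suc k → sgn j (X 0 j * detℕ k (minor j X)) ≈
        (sgn j (Y 0 j * detℕ k (minor j Y)) + sgn j (Z 0 j * detℕ k (minor j Z)))
    term j pj with j ℕ.≟ col
    ... | yes P.refl = trans (sgn-cong j (trans (*-cong (on 0 (s≤s z≤n)) refl)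
                          (trans (distribʳ _ _ _) (+-cong (*-congˡ dY) (*-congˡ dZ))))) (sgn-distrib-+ j _ _)
      where
      dY : detℕ k (minor j X) ≈ detℕ k (minor j Y)
      dY = detℕ-cong k (λ r s pr ps → proj₁ (off (suc r) (punchInℕ j s) (s≤s pr) (punchInℕ-< j s ps) (punchInℕ-≢ j s)))
      dZ : detℕ k (minor j X) ≈ detℕ k (minor j Z)
      dZ = detℕ-cong k (λ r s pr ps → proj₂ (off (suc r) (punchInℕ j s) (s≤s pr) (punchInℕ-< j s ps) (punchInℕ-≢ j s)))
    ... | no j≢col with punchInℕ-surjective j col k col<k pj (λ e → j≢col (P.sym e))
    ... | col' , col≡ , col'<k = trans (sgn-cong j (trans (*-congˡ ih)
           (trans (distribˡ _ _ _) (+-cong (*-congʳ (proj₁ e0)) (*-congʳ (proj₂ e0)))))) (sgn-distrib-+ j _ _)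
      where
      e0 : (X 0 j ≈ Y 0 j) × (X 0 j ≈ Z 0 j)
      e0 = off 0 j (s≤s z≤n) pj j≢col
      ih : detℕ k (minor j X) ≈ (detℕ k (minor j Y) + detℕ k (minor j Z))
      ih = detℕ-additiveCol k col' col'<k
             (λ r s pr ps ne → off (suc r) (punchInℕ j s) (s≤s pr) (punchInℕ-< j s ps)
                 (λ e → ne (punchInℕ-injective j s col' (P.trans e (P.sym col≡)))))
             (λ r pr → P.subst (λ z → X (suc r) z ≈ (Y (suc r) z + Z (suc r) z)) (P.sym col≡) (on (suc r) (s≤s pr)))

  detℕ-scaleCol : ∀ k col → col < k → (a : Carrier) → {X Y : Matrix} →
           (∀ r s → r < k → s < k → s ≢ col → X r s ≈ Y r s) →
           (∀ r → r < k → X r col ≈ (a * Y r col)) →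
           detℕ k X ≈ (a * detℕ k Y)
  detℕ-scaleCol (suc k) col col<k a {X} {Y} off on =
    trans (Σ<-cong (suc k) term) (sym (Σ<-*ˡ (suc k) a (λ j → sgn j (Y 0 j * detℕ k (minor j Y)))))
    where
    term : ∀ j → j < suc k → sgn j (X 0 j * detℕ k (minor j X)) ≈ (a * sgn j (Y 0 j * detℕ k (minor j Y)))
    term j pj with j ℕ.≟ col
    ... | yes P.refl = trans (sgn-cong j (trans (*-cong (on 0 (s≤s z≤n)) dY) (*-assoc _ _ _))) (sym (sgn-*ʳ j _ _))
      where
      dY : detℕ k (minor j X) ≈ detℕ k (minor j Y)
      dY = detℕ-cong k (λ r s pr ps → off (suc r) (punchInℕ j s) (s≤s pr) (punchInℕ-< j s ps) (punchInℕ-≢ j s))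
    ... | no j≢col with punchInℕ-surjective j col k col<k pj (λ e → j≢col (P.sym e))
    ... | col' , col≡ , col'<k = trans (sgn-cong j (trans (*-cong (off 0 j (s≤s z≤n) pj j≢col) ih) (*-leftComm _ _ _))) (sym (sgn-*ʳ j _ _))
      where
      ih : detℕ k (minor j X) ≈ (a * detℕ k (minor j Y))
      ih = detℕ-scaleCol k col' col'<k a
             (λ r s pr ps ne → off (suc r) (punchInℕ j s) (s≤s pr) (punchInℕ-< j s ps)
                 (λ e → ne (punchInℕ-injective j s col' (P.trans e (P.sym col≡)))))
             (λ r pr → P.subst (λ z → X (suc r) z ≈ (a * Y (suc r) z)) (P.sym col≡) (on (suc r) (s≤s pr)))

  -- The terms of the two equal columns cancel, and every other minor again has two equal
  -- adjacent columns.
  detℕ-equalAdjacentCols : ∀ k col → suc col < k → {X : Matrix} → (∀ r → r < k → X r col ≈ X r (suc col)) → detℕ k X ≈ 0#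
  detℕ-equalAdjacentCols (suc k) col p {X} h = Σ<-pair (suc k) col p _ otherTermVanishes adjacentTermsCancel
    where
    otherTermVanishes : ∀ j → j < suc k → j ≢ col → j ≢ suc col → sgn j (X 0 j * detℕ k (minor j X)) ≈ 0#
    otherTermVanishes j pj n1 n2 with ℕP.<-cmp j col
    ... | tri≈ _ e _ = ⊥-elim (n1 e)
    otherTermVanishes j pj n1 n2 | tri< j<col _ _ with <⇒≤pred j<col
    ... | col' , col≡suc , j≤col' = sgn-zeroʳ j _ (detℕ-equalAdjacentCols k col' col'+1<k equalColumns)
      where
      col'+1<k : suc col' < k
      col'+1<k = ℕP.≤-pred (P.subst (λ z → suc z < suc k) col≡suc p)
      e1 : punchInℕ j col' ≡ col
      e1 = P.trans (punchInℕ-above j col' j≤col') (P.sym col≡suc)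
      e2 : punchInℕ j (suc col') ≡ suc col
      e2 = P.trans (punchInℕ-above j (suc col') (ℕP.≤-trans j≤col' (ℕP.n≤1+n col'))) (P.cong suc (P.sym col≡suc))
      equalColumns : ∀ r → r < k → X (suc r) (punchInℕ j col') ≈ X (suc r) (punchInℕ j (suc col'))
      equalColumns r pr = P.subst₂ (λ u v → X (suc r) u ≈ X (suc r) v) (P.sym e1) (P.sym e2) (h (suc r) (s≤s pr))
    otherTermVanishes j pj n1 n2 | tri> _ _ col<j with ℕP.<-cmp j (suc col)
    ... | tri≈ _ e _ = ⊥-elim (n2 e)
    ... | tri< a _ _ = ⊥-elim (ℕP.<⇒≱ a col<j)
    ... | tri> _ _ col+1<j = sgn-zeroʳ j _ (detℕ-equalAdjacentCols k col (ℕP.≤-trans col+1<j (ℕP.≤-pred pj)) equalColumns)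
      where
      equalColumns : ∀ r → r < k → X (suc r) (punchInℕ j col) ≈ X (suc r) (punchInℕ j (suc col))
      equalColumns r pr rewrite punchInℕ-below j col col<j | punchInℕ-below j (suc col) col+1<j = h (suc r) (s≤s pr)
    sameMinor : detℕ k (minor col X) ≈ detℕ k (minor (suc col) X)
    sameMinor = detℕ-cong k (λ r s pr ps → sameEntry r s pr)
      where
      sameEntry : ∀ r s → r < k → X (suc r) (punchInℕ col s) ≈ X (suc r) (punchInℕ (suc col) s)
      sameEntry r s pr with punchInℕ-adjacent col s
      ... | inj₁ e = reflexive (P.cong (X (suc r)) e)
      ... | inj₂ P.refl = P.subst₂ (λ u v → X (suc r) u ≈ X (suc r) v) (P.sym (punchInℕ-above s s ℕP.≤-refl))
          (P.sym (punchInℕ-below (suc s) s ℕP.≤-refl)) (sym (h (suc r) (s≤s pr)))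
    adjacentTermsCancel : (sgn col (X 0 col * detℕ k (minor col X)) + sgn (suc col) (X 0 (suc col) * detℕ k (minor (suc col) X))) ≈ 0#
    adjacentTermsCancel = trans (+-congˡ (trans (sgn-suc col _) (-‿cong (sgn-cong col (*-cong (sym (h 0 (s≤s z≤n))) (sym sameMinor))))))
                 (-‿inverseʳ _)

  Π< : ℕ → (ℕ → Carrier) → Carrier
  Π< zero f = 1#
  Π< (suc k) f = f 0 * Π< k (λ i → f (suc i))

  detℕ-scaleRows : ∀ k (f : ℕ → Carrier) (X : Matrix) → detℕ k (λ r s → f r * X r s) ≈ (Π< k f * detℕ k X)
  detℕ-scaleRows zero f X = sym (*-identityˡ 1#)
  detℕ-scaleRows (suc k) f X =
    trans (Σ<-cong (suc k) (λ j pj → trans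
        (sgn-cong j (trans (*-congˡ (detℕ-scaleRows k (λ i → f (suc i)) (minor j X))) (*-interchange _ _ _ _)))
                                          (sym (sgn-*ʳ j _ _))))
          (sym (Σ<-*ˡ (suc k) (f 0 * Π< k (λ i → f (suc i))) (λ j → sgn j (X 0 j * detℕ k (minor j X)))))

  sgn-*-Σ< : ∀ n a k (f : ℕ → Carrier) → sgn n (a * Σ< k f) ≈ Σ< k (λ i → sgn n (a * f i))
  sgn-*-Σ< n a k f = trans (sgn-cong n (Σ<-*ˡ k a f)) (sgn-Σ< n k _)

  sgn-*-sgn : ∀ n m a y → sgn n (a * sgn m y) ≈ sgn (n ℕ.+ m) (a * y)
  sgn-*-sgn n m a y = trans (sgn-cong n (sgn-*ʳ m a y)) (sym (sgn-+ n m _))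

  sgn-≡ : ∀ {n m} y → n ≡ m → sgn n y ≈ sgn m y
  sgn-≡ y P.refl = refl

  detℕ-expandCol : ∀ k (X : Matrix) → detℕ (suc k) X ≈ Σ< (suc k) (λ i → sgn i (X i 0 * detℕ k (λ r s → X (punchInℕ i r) (suc s))))
  detℕ-expandCol zero X = trans (reflexive Σ<-suc)
      (trans (+-congˡ (reflexive (P.trans Σ<-zero (P.sym Σ<-zero)))) (sym (reflexive Σ<-suc)))
  detℕ-expandCol (suc k) X = trans (reflexive Σ<-suc) (trans (+-congˡ (begin
      Σ< (suc k) (λ j → sgn (suc j) (X 0 (suc j) * detℕ (suc k) (minor (suc j) X)))
    ≈⟨ Σ<-cong (suc k) (λ j _ → sgn-cong (suc j) (*-congˡ (detℕ-expandCol k (minor (suc j) X)))) ⟩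
      Σ< (suc k) (λ j → sgn (suc j) (X 0 (suc j) * Σ< (suc k) (λ i → sgn i (X (suc i) 0 * D i j))))
    ≈⟨ Σ<-cong (suc k) (λ j _ → trans (sgn-*-Σ< (suc j) (X 0 (suc j)) (suc k) (λ i → sgn i (X (suc i) 0 * D i j)))
        (Σ<-cong (suc k) (λ i _ → sgn-*-sgn (suc j) i (X 0 (suc j)) (X (suc i) 0 * D i j)))) ⟩
      Σ< (suc k) (λ j → Σ< (suc k) (λ i → sgn (suc j ℕ.+ i) (X 0 (suc j) * (X (suc i) 0 * D i j))))
    ≈⟨ Σ<-swap (suc k) (suc k) (λ j i → sgn (suc j ℕ.+ i) (X 0 (suc j) * (X (suc i) 0 * D i j))) ⟩
      Σ< (suc k) (λ i → Σ< (suc k) (λ j → sgn (suc j ℕ.+ i) (X 0 (suc j) * (X (suc i) 0 * D i j))))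
    ≈⟨ Σ<-cong (suc k) (λ i _ → Σ<-cong (suc k)
        (λ j _ → trans (sgn-≡ (X 0 (suc j) * (X (suc i) 0 * D i j)) (P.cong suc (ℕP.+-comm j i)))
            (sgn-cong (suc i ℕ.+ j) (*-leftComm (X 0 (suc j)) (X (suc i) 0) (D i j))))) ⟩
      Σ< (suc k) (λ i → Σ< (suc k) (λ j → sgn (suc i ℕ.+ j) (X (suc i) 0 * (X 0 (suc j) * D i j))))
    ≈⟨ sym (Σ<-cong (suc k) (λ i _ → trans (sgn-*-Σ< (suc i) (X (suc i) 0) (suc k) (λ j → sgn j (X 0 (suc j) * D i j)))
        (Σ<-cong (suc k) (λ j _ → sgn-*-sgn (suc i) j (X (suc i) 0) (X 0 (suc j) * D i j))))) ⟩
      Σ< (suc k) (λ i → sgn (suc i) (X (suc i) 0 * Σ< (suc k) (λ j → sgn j (X 0 (suc j) * D i j))))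
    ∎)) (sym (reflexive Σ<-suc)))
    where
    D : ℕ → ℕ → Carrier
    D i j = detℕ k (λ r s → X (suc (punchInℕ i r)) (suc (punchInℕ j s)))

  detℕ-transpose : ∀ k (X : Matrix) → detℕ k (λ r s → X s r) ≈ detℕ k X
  detℕ-transpose zero X = refl
  detℕ-transpose (suc k) X = trans
      (Σ<-cong (suc k) (λ j _ → sgn-cong j (*-congˡ (detℕ-transpose k (λ r s → X (punchInℕ j r) (suc s))))))
                                 (sym (detℕ-expandCol k X))

  -- Induction on i: in the expansion along row 0 the term of column l vanishes, and every other
  -- minor has its unit row at i − 1.
  detℕ-unitRow : ∀ k i l {X : Matrix} → i < suc k → l < suc k → (∀ s → s < suc k → s ≢ l → X i s ≈ 0#) →
            detℕ (suc k) X ≈ sgn (i ℕ.+ l) (X i l * detℕ k (λ r s → X (punchInℕ i r) (punchInℕ l s)))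
  detℕ-unitRow k zero l {X} pi pl h = Σ<-single (suc k) l pl (λ j → sgn j (X 0 j * detℕ k (minor j X)))
      (λ j pj ne → sgn-zeroˡ j _ (h j pj ne))
  detℕ-unitRow (suc k) (suc i) l {X} (s≤s pi) pl h = begin
      detℕ (suc (suc k)) X
    ≈⟨ Σ<-extract (suc k) l (ℕP.≤-pred pl) g ⟩
      (sgn l (X 0 l * detℕ (suc k) (minor l X)) + Σ< (suc k) (λ j' → g (punchInℕ l j')))
    ≈⟨ +-cong (sgn-zeroʳ l (X 0 l)
        (detℕ-zeroRow (suc k) i {minor l X} pi (λ s ps → h (punchInℕ l s) (punchInℕ-< l s ps) (punchInℕ-≢ l s))))
            (Σ<-cong (suc k) term) ⟩
      (0# + Σ< (suc k) (λ j' → sgn (suc i ℕ.+ l) (X (suc i) l * sgn j' (X 0 (punchInℕ l j') * E j'))))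
    ≈⟨ +-identityˡ (Σ< (suc k) (λ j' → sgn (suc i ℕ.+ l) (X (suc i) l * sgn j' (X 0 (punchInℕ l j') * E j')))) ⟩
      Σ< (suc k) (λ j' → sgn (suc i ℕ.+ l) (X (suc i) l * sgn j' (X 0 (punchInℕ l j') * E j')))
    ≈⟨ sym (sgn-*-Σ< (suc i ℕ.+ l) (X (suc i) l) (suc k) (λ j' → sgn j' (X 0 (punchInℕ l j') * E j'))) ⟩
      sgn (suc i ℕ.+ l) (X (suc i) l * detℕ (suc k) (λ r s → X (punchInℕ (suc i) r) (punchInℕ l s)))
    ∎
    where
    g : ℕ → Carrier
    g j = sgn j (X 0 j * detℕ (suc k) (minor j X))
    E : ℕ → Carrier
    E j' = detℕ k (λ r s → X (suc (punchInℕ i r)) (punchInℕ l (punchInℕ j' s)))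
    term : ∀ j' → j' < suc k → g (punchInℕ l j') ≈ sgn (suc i ℕ.+ l) (X (suc i) l * sgn j' (X 0 (punchInℕ l j') * E j'))
    term j' pj' with punchInℕ-exchange l j'
    ... | l' , e1 , e2 , par = begin
        g (punchInℕ l j')
      ≈⟨ sgn-cong (punchInℕ l j') (*-congˡ ih) ⟩
        sgn (punchInℕ l j') (X 0 (punchInℕ l j') * sgn (i ℕ.+ l') (X (suc i) (punchInℕ (punchInℕ l j') l') * E' ))
      ≈⟨ sgn-*-sgn (punchInℕ l j') (i ℕ.+ l') (X 0 (punchInℕ l j')) (X (suc i) (punchInℕ (punchInℕ l j') l') * E') ⟩
        sgn (punchInℕ l j' ℕ.+ (i ℕ.+ l')) (X 0 (punchInℕ l j') * (X (suc i) (punchInℕ (punchInℕ l j') l') * E'))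
      ≈⟨ sgn-cong (punchInℕ l j' ℕ.+ (i ℕ.+ l'))
          (*-congˡ (*-cong (reflexive (P.cong (X (suc i)) e1))
              (detℕ-cong k (λ r s _ _ → reflexive (P.cong (X (suc (punchInℕ i r))) (e2 s)))))) ⟩
        sgn (punchInℕ l j' ℕ.+ (i ℕ.+ l')) (X 0 (punchInℕ l j') * (X (suc i) l * E j'))
      ≈⟨ sgn-cong (punchInℕ l j' ℕ.+ (i ℕ.+ l')) (*-leftComm (X 0 (punchInℕ l j')) (X (suc i) l) (E j')) ⟩
        sgn (punchInℕ l j' ℕ.+ (i ℕ.+ l')) (X (suc i) l * (X 0 (punchInℕ l j') * E j'))
      ≈⟨ sameSign par ⟩
        sgn (suc i ℕ.+ l ℕ.+ j') (X (suc i) l * (X 0 (punchInℕ l j') * E j'))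
      ≈⟨ sym (sgn-*-sgn (suc i ℕ.+ l) j' (X (suc i) l) (X 0 (punchInℕ l j') * E j')) ⟩
        sgn (suc i ℕ.+ l) (X (suc i) l * sgn j' (X 0 (punchInℕ l j') * E j'))
      ∎
      where
      j : ℕ
      j = punchInℕ l j'
      E' : Carrier
      E' = detℕ k (λ r s → X (suc (punchInℕ i r)) (punchInℕ j (punchInℕ l' s)))
      pj : j < suc (suc k)
      pj = punchInℕ-< l j' pj'
      lj : l ≢ j
      lj e = punchInℕ-≢ l j' (P.sym e)
      pl' : l' < suc k
      pl' with punchInℕ-surjective j l (suc k) pl pj lj
      ... | l'' , e'' , b'' = P.subst (λ z → z < suc k) (punchInℕ-injective j l'' l' (P.trans e'' (P.sym e1))) b''
      ih : detℕ (suc k) (minor j X) ≈ sgn (i ℕ.+ l') (X (suc i) (punchInℕ j l') * E')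
      ih = detℕ-unitRow k i l' {minor j X} pi pl'
             (λ s ps ne → h (punchInℕ j s) (punchInℕ-< j s ps) (λ e → ne (punchInℕ-injective j s l' (P.trans e (P.sym e1)))))
      reassoc : ∀ j i l' → j ℕ.+ (i ℕ.+ l') ≡ i ℕ.+ (j ℕ.+ l')
      reassoc = ℕSolver.solve-∀
      reassoc₂ : ∀ j i l' → suc (suc (j ℕ.+ (i ℕ.+ l'))) ≡ i ℕ.+ suc (suc (j ℕ.+ l'))
      reassoc₂ = ℕSolver.solve-∀
      reassoc′ : ∀ i l j' → i ℕ.+ suc (l ℕ.+ j') ≡ suc i ℕ.+ l ℕ.+ j'
      reassoc′ = ℕSolver.solve-∀
      sameSign : ∀ {y} → ((j ℕ.+ l' ≡ suc (l ℕ.+ j')) ⊎ (suc (suc (j ℕ.+ l')) ≡ suc (l ℕ.+ j'))) →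
                 sgn (j ℕ.+ (i ℕ.+ l')) y ≈ sgn (suc i ℕ.+ l ℕ.+ j') y
      sameSign {y} (inj₁ q) = sgn-≡ y (P.trans (reassoc j i l') (P.trans (P.cong (i ℕ.+_) q) (reassoc′ i l j')))
      sameSign {y} (inj₂ q) = sgn-≡ y (P.trans (reassoc₂ j i l') (P.trans (P.cong (i ℕ.+_) q) (reassoc′ i l j')))

  detℕ-zeroBlock : ∀ k (R C : ℕ → Bool) {X : Matrix} → (∀ r s → r < k → s < k → R r ≡ true → C s ≡ false → X r s ≈ 0#) →
         count< k C < count< k R → detℕ k X ≈ 0#
  detℕ-zeroBlock zero R C h ()
  detℕ-zeroBlock (suc k) R C {X} h lt = Σ<-≈0 (suc k) {λ j → sgn j (X 0 j * detℕ k (minor j X))} term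
    where
    term : ∀ j → j < suc k → sgn j (X 0 j * detℕ k (minor j X)) ≈ 0#
    term j pj with count<-extract k j (ℕP.≤-pred pj) C
    ... | ec with R 0 in eR | C j in eC
    ... | true | false = sgn-zeroˡ j _ (h 0 j (s≤s z≤n) pj eR eC)
    ... | true | true = sgn-zeroʳ j _ (detℕ-zeroBlock k (λ i → R (suc i)) (λ i → C (punchInℕ j i))
              (λ r s pr ps er es → h (suc r) (punchInℕ j s) (s≤s pr) (punchInℕ-< j s ps) er es)
              (ℕP.≤-pred (P.subst (λ z → z < suc (count< k (λ i → R (suc i)))) ec lt)))
    ... | false | cj = sgn-zeroʳ j _ (detℕ-zeroBlock k (λ i → R (suc i)) (λ i → C (punchInℕ j i))
              (λ r s pr ps er es → h (suc r) (punchInℕ j s) (s≤s pr) (punchInℕ-< j s ps) er es)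
              (ℕP.≤-<-trans (ℕP.m≤n+m _ (boolToℕ cj)) (P.subst (λ z → z < count< k (λ i → R (suc i))) ec lt)))

  -- antiBlock t a P Q = [[0, P], [Q, 0]] with P of size t × t and Q of size a × a.
  antiBlock : ℕ → ℕ → Matrix → Matrix → Matrix
  antiBlock t a P Q r s = if ltb r t then (if ltb s a then 0# else P r (s ∸ a)) else (if ltb s a then Q (r ∸ t) s else 0#)

  detℕ-antiBlock : ∀ t a (P Q : Matrix) → detℕ (t ℕ.+ a) (antiBlock t a P Q) ≈ sgn (t ℕ.* a) (detℕ t P * detℕ a Q)
  detℕ-antiBlock zero a P Q = trans (detℕ-cong a ent) (sym (*-identityˡ _))
    where
    ent : ∀ r s → r < a → s < a → antiBlock 0 a P Q r s ≈ Q r s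
    ent r s _ ps rewrite ltb-true ps = refl
  detℕ-antiBlock (suc t) a P Q = begin
      Σ< (suc (t ℕ.+ a)) g
    ≈⟨ reflexive (P.cong (λ n → Σ< n g) (ℕP.+-comm (suc t) a)) ⟩
      Σ< (a ℕ.+ suc t) g
    ≈⟨ Σ<-split a (suc t) g ⟩
      (Σ< a g + Σ< (suc t) (λ j → g (a ℕ.+ j)))
    ≈⟨ +-cong (Σ<-≈0 a {g} (λ j pj → sgn-zeroˡ j _ (reflexive (P.cong (λ b → if b then 0# else P 0 (j ∸ a)) (ltb-true pj)))))
              (Σ<-cong (suc t) term) ⟩
      (0# + Σ< (suc t) (λ j → sgn (a ℕ.+ t ℕ.* a) (sgn j (P 0 j * detℕ t (minor j P)) * detℕ a Q)))
    ≈⟨ +-identityˡ _ ⟩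
      Σ< (suc t) (λ j → sgn (a ℕ.+ t ℕ.* a) (sgn j (P 0 j * detℕ t (minor j P)) * detℕ a Q))
    ≈⟨ sym (sgn-Σ< (a ℕ.+ t ℕ.* a) (suc t) (λ j → sgn j (P 0 j * detℕ t (minor j P)) * detℕ a Q)) ⟩
      sgn (a ℕ.+ t ℕ.* a) (Σ< (suc t) (λ j → sgn j (P 0 j * detℕ t (minor j P)) * detℕ a Q))
    ≈⟨ sgn-cong (a ℕ.+ t ℕ.* a) (sym (Σ<-*ʳ (suc t) (detℕ a Q) (λ j → sgn j (P 0 j * detℕ t (minor j P))))) ⟩
      sgn (suc t ℕ.* a) (detℕ (suc t) P * detℕ a Q)
    ∎
    where
    B : Matrix
    B = antiBlock (suc t) a P Q
    g : ℕ → Carrier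
    g j = sgn j (B 0 j * detℕ (t ℕ.+ a) (minor j B))
    ent : ∀ j r s → B 0 (a ℕ.+ j) ≡ P 0 j × (minor (a ℕ.+ j) B r s ≈ antiBlock t a (minor j P) Q r s)
    ent j r s with s ℕP.<? a
    ... | yes s<a rewrite ltb-false (ℕP.m≤m+n a j) | ℕP.m+n∸m≡n a j | punchInℕ-below (a ℕ.+ j) s
        (ℕP.≤-trans s<a (ℕP.m≤m+n a j)) | ltb-true s<a = P.refl , refl
    ... | no s≮a rewrite ltb-false (ℕP.m≤m+n a j) | ℕP.m+n∸m≡n a j | punchInℕ-+ a j s (ℕP.≮⇒≥ s≮a) | ltb-false (ℕP.≮⇒≥ s≮a)
                         | ltb-false (ℕP.m≤m+n a (punchInℕ j (s ∸ a))) | ℕP.m+n∸m≡n a (punchInℕ j (s ∸ a)) = P.refl , refl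
    term : ∀ j → j < suc t → g (a ℕ.+ j) ≈ sgn (a ℕ.+ t ℕ.* a) (sgn j (P 0 j * detℕ t (minor j P)) * detℕ a Q)
    term j _ = begin
        sgn (a ℕ.+ j) (B 0 (a ℕ.+ j) * detℕ (t ℕ.+ a) (minor (a ℕ.+ j) B))
      ≈⟨ sgn-cong (a ℕ.+ j) (*-cong (reflexive (proj₁ (ent j 0 0)))
          (trans (detℕ-cong (t ℕ.+ a) (λ r s _ _ → proj₂ (ent j r s))) (detℕ-antiBlock t a (minor j P) Q))) ⟩
        sgn (a ℕ.+ j) (P 0 j * sgn (t ℕ.* a) (detℕ t (minor j P) * detℕ a Q))
      ≈⟨ sgn-*-sgn (a ℕ.+ j) (t ℕ.* a) (P 0 j) _ ⟩
        sgn (a ℕ.+ j ℕ.+ t ℕ.* a) (P 0 j * (detℕ t (minor j P) * detℕ a Q))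
      ≈⟨ sgn-≡ _ (+-right-comm a j (t ℕ.* a)) ⟩
        sgn (a ℕ.+ t ℕ.* a ℕ.+ j) (P 0 j * (detℕ t (minor j P) * detℕ a Q))
      ≈⟨ sgn-+ (a ℕ.+ t ℕ.* a) j _ ⟩
        sgn (a ℕ.+ t ℕ.* a) (sgn j (P 0 j * (detℕ t (minor j P) * detℕ a Q)))
      ≈⟨ sgn-cong (a ℕ.+ t ℕ.* a) (trans (sgn-cong j (sym (*-assoc _ _ _))) (sym (sgn-*ˡ j _ _))) ⟩
        sgn (a ℕ.+ t ℕ.* a) (sgn j (P 0 j * detℕ t (minor j P)) * detℕ a Q)
      ∎
      where
      +-right-comm : ∀ a j ta → a ℕ.+ j ℕ.+ ta ≡ a ℕ.+ ta ℕ.+ j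
      +-right-comm = ℕSolver.solve-∀

  vandermonde : (ℕ → Carrier) → Matrix
  vandermonde a r s = a r ^ s

  -- The Vandermonde matrix with every column s ≥ t replaced by C_s − a₀ C_{s−1}.
  reducedVandermonde : (ℕ → Carrier) → ℕ → Matrix
  reducedVandermonde a t r s = if ltb s t then a r ^ s else (a r ^ s + (- (a 0 * a r ^ (s ∸ 1))))

  -- Column t of reducedVandermonde a t is C_t + (− a₀) C_{t−1}; by linearity the second summand
  -- contributes a matrix whose columns t − 1 and t are equal.
  detℕ-reduceColumn : ∀ k a t → 1 ≤ t → t < k → detℕ k (reducedVandermonde a t) ≈ detℕ k (reducedVandermonde a (suc t))
  detℕ-reduceColumn k a (suc t') _ pt = begin
      detℕ k (reducedVandermonde a t)
    ≈⟨ detℕ-additiveCol k t pt {reducedVandermonde a t} {reducedVandermonde a (suc t)} {W} off on ⟩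
      (detℕ k (reducedVandermonde a (suc t)) + detℕ k W)
    ≈⟨ +-congˡ (detℕ-scaleCol k t pt (- a 0) {W} {W'} offW onW) ⟩
      (detℕ k (reducedVandermonde a (suc t)) + ((- a 0) * detℕ k W'))
    ≈⟨ +-congˡ (trans (*-congˡ (detℕ-equalAdjacentCols k t' pt adj)) (zeroʳ _)) ⟩
      (detℕ k (reducedVandermonde a (suc t)) + 0#)
    ≈⟨ +-identityʳ _ ⟩
      detℕ k (reducedVandermonde a (suc t))
    ∎
    where
    t : ℕ
    t = suc t'
    W : Matrix
    W r s = if eqb s t then ((- a 0) * a r ^ t') else reducedVandermonde a (suc t) r s
    W' : Matrix
    W' r s = if eqb s t then a r ^ t' else reducedVandermonde a (suc t) r s
    off : ∀ r s → r < k → s < k → s ≢ t → (reducedVandermonde a t r s ≈ reducedVandermonde a (suc t) r s) ×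
        (reducedVandermonde a t r s ≈ W r s)
    off r s _ _ ne rewrite eqb-false ne | ltb-suc s t ne = refl , refl
    on : ∀ r → r < k → reducedVandermonde a t r t ≈ (reducedVandermonde a (suc t) r t + W r t)
    on r _ rewrite eqb-refl t | ltb-false {t} {t} ℕP.≤-refl | ltb-true {t} {suc t} ℕP.≤-refl = +-congˡ (-‿distribˡ-* (a 0) (a r ^ t'))
    offW : ∀ r s → r < k → s < k → s ≢ t → W r s ≈ W' r s
    offW r s _ _ ne rewrite eqb-false ne = refl
    onW : ∀ r → r < k → W r t ≈ ((- a 0) * W' r t)
    onW r _ rewrite eqb-refl t = refl
    adj : ∀ r → r < k → W' r t' ≈ W' r (suc t')
    adj r _ rewrite eqb-refl t | eqb-false {t'} {t} (λ e → ℕP.1+n≢n (P.sym e)) | ltb-true {t'} {suc t}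
        (ℕP.≤-trans (ℕP.n≤1+n t) ℕP.≤-refl) = refl

  detℕ-reduceColumns : ∀ k a d t → 1 ≤ t → t ℕ.+ d ≡ k → detℕ k (reducedVandermonde a t) ≈ detℕ k (reducedVandermonde a k)
  detℕ-reduceColumns k a zero t p e rewrite ℕP.+-identityʳ t | e = refl
  detℕ-reduceColumns k a (suc d) t p e = trans (detℕ-reduceColumn k a t p (P.subst (t <_) e (ℕP.m<m+n t (s≤s z≤n))))
                                  (detℕ-reduceColumns k a d (suc t) (s≤s z≤n) (P.trans (P.sym (ℕP.+-suc t d)) e))

  x-y≈0⇒x≈y : ∀ x y → (x + (- y)) ≈ 0# → x ≈ y
  x-y≈0⇒x≈y x y e = trans (+-inverseˡ-unique x (- y) e) (-‿involutive y)

  -- Once every column is reduced, row 0 is (1, 0, …, 0) and row r + 1 is (a_{r+1} − a₀) times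
  -- the Vandermonde row of a_{r+1}.
  detℕ-vandermonde-step : ∀ k a → detℕ (suc k) (vandermonde a) ≈
      (Π< k (λ r → a (suc r) + (- a 0)) * detℕ k (vandermonde (λ i → a (suc i))))
  detℕ-vandermonde-step k a = begin
      detℕ (suc k) (vandermonde a)
    ≈⟨ detℕ-cong (suc k) (λ r s _ ps → reflexive
        (P.cong (λ b → if b then a r ^ s else (a r ^ s + (- (a 0 * a r ^ (s ∸ 1))))) (P.sym (ltb-true ps)))) ⟩
      detℕ (suc k) (reducedVandermonde a (suc k))
    ≈⟨ sym (detℕ-reduceColumns (suc k) a k 1 (s≤s z≤n) P.refl) ⟩
      detℕ (suc k) (reducedVandermonde a 1)
    ≈⟨ detℕ-unitRow k 0 0 {reducedVandermonde a 1} (s≤s z≤n) (s≤s z≤n) row0 ⟩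
      (1# * detℕ k (λ r s → reducedVandermonde a 1 (suc r) (suc s)))
    ≈⟨ *-identityˡ _ ⟩
      detℕ k (λ r s → reducedVandermonde a 1 (suc r) (suc s))
    ≈⟨ detℕ-cong k (λ r s _ _ → fac r s) ⟩
      detℕ k (λ r s → (a (suc r) + (- a 0)) * vandermonde (λ i → a (suc i)) r s)
    ≈⟨ detℕ-scaleRows k _ _ ⟩
      (Π< k (λ r → a (suc r) + (- a 0)) * detℕ k (vandermonde (λ i → a (suc i))))
    ∎
    where
    row0 : ∀ s → s < suc k → s ≢ 0 → reducedVandermonde a 1 0 s ≈ 0#
    row0 zero _ ne = ⊥-elim (ne P.refl)
    row0 (suc s) _ _ = -‿inverseʳ _
    fac : ∀ r s → reducedVandermonde a 1 (suc r) (suc s) ≈ ((a (suc r) + (- a 0)) * a (suc r) ^ s)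
    fac r s = trans (+-congˡ (-‿distribˡ-* _ _)) (sym (distribʳ _ _ _))

  *-≉0 : ∀ {x y} → ¬ (x ≈ 0#) → ¬ (y ≈ 0#) → ¬ ((x * y) ≈ 0#)
  *-≉0 {x} {y} nx ny e with inverse x nx
  ... | x' , ex = ny (begin
      y                ≈⟨ sym (*-identityˡ y) ⟩
      (1# * y)         ≈⟨ *-congʳ (sym ex) ⟩
      ((x * x') * y)   ≈⟨ *-congʳ (*-comm x x') ⟩
      ((x' * x) * y)   ≈⟨ *-assoc _ _ _ ⟩
      (x' * (x * y))   ≈⟨ *-congˡ e ⟩
      (x' * 0#)        ≈⟨ zeroʳ x' ⟩
      0# ∎)

  Π<-≉0 : ∀ k (f : ℕ → Carrier) → (∀ i → i < k → ¬ (f i ≈ 0#)) → ¬ (Π< k f ≈ 0#)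
  Π<-≉0 zero f h = 1≉0
  Π<-≉0 (suc k) f h = *-≉0 (h 0 (s≤s z≤n)) (Π<-≉0 k (λ i → f (suc i)) (λ i p → h (suc i) (s≤s p)))

  Injective< : ℕ → (ℕ → Carrier) → Set ℓ
  Injective< n a = ∀ i j → i < n → j < n → a i ≈ a j → i ≡ j

  detℕ-vandermonde≉0 : ∀ k (a : ℕ → Carrier) → Injective< k a → ¬ (detℕ k (vandermonde a) ≈ 0#)
  detℕ-vandermonde≉0 zero a a-inj = 1≉0
  detℕ-vandermonde≉0 (suc k) a a-inj e =
    *-≉0 (Π<-≉0 k _ (λ i p e' → ℕP.1+n≢0 (a-inj (suc i) 0 (s≤s p) (s≤s z≤n) (x-y≈0⇒x≈y _ _ e'))))
           (detℕ-vandermonde≉0 k (λ i → a (suc i)) (λ i j pi pj e' → ℕP.suc-injective (a-inj (suc i) (suc j) (s≤s pi) (s≤s pj) e')))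
           (trans (sym (detℕ-vandermonde-step k a)) e)

module Coefficients {c ℓ} (F : Field c ℓ) where
  open Field F hiding (zero)
  open PolyRing F
  open Determinant F
  open import Relation.Binary.Reasoning.Setoid setoid

  δ : ∀ {n} → Monomial n → Monomial n → Carrier
  δ u a with ≡-dec ℕ._≟_ a u
  ... | yes _ = 1#
  ... | no _ = 0#

  δℕ : ℕ → ℕ → Carrier
  δℕ u a with a ℕ.≟ u
  ... | yes _ = 1#
  ... | no _ = 0#

  X-coeff : ∀ {n} (i : Fin n) a → X i a ≈ δ (unitMon i) a
  X-coeff i a with ≡-dec ℕ._≟_ a (unitMon i)
  ... | yes _ = refl
  ... | no _ = refl

  const-coeff : ∀ {n} k a → const {n} k a ≈ (δ (replicate n 0) a * k)
  const-coeff {n} k a with ≡-dec ℕ._≟_ a (replicate n 0)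
  ... | yes _ = sym (*-identityˡ k)
  ... | no _ = sym (zeroˡ k)

  δ-cons : ∀ {n} u0 (us : Vec ℕ n) x xs → δ (u0 ∷ us) (x ∷ xs) ≈ (δℕ u0 x * δ us xs)
  δ-cons u0 us x xs with ≡-dec ℕ._≟_ (x ∷ xs) (u0 ∷ us) | x ℕ.≟ u0 | ≡-dec ℕ._≟_ xs us
  ... | yes _ | yes _ | yes _ = sym (*-identityˡ 1#)
  ... | yes e | no ne | _ = ⊥-elim (ne (∷-injectiveˡ e))
  ... | yes e | yes _ | no ne = ⊥-elim (ne (∷-injectiveʳ e))
  ... | no ne | yes P.refl | yes P.refl = ⊥-elim (ne P.refl)
  ... | no _ | no _ | _ = sym (zeroˡ _)
  ... | no _ | yes _ | no _ = sym (zeroʳ _)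

  δ-refl : ∀ {n} (u : Monomial n) → δ u u ≈ 1#
  δ-refl u with ≡-dec ℕ._≟_ u u
  ... | yes _ = refl
  ... | no ne = ⊥-elim (ne P.refl)

  δ-≢ : ∀ {n} (u a : Monomial n) → a ≢ u → δ u a ≈ 0#
  δ-≢ u a ne with ≡-dec ℕ._≟_ a u
  ... | yes e = ⊥-elim (ne e)
  ... | no _ = refl

  δℕ-refl : ∀ u → δℕ u u ≈ 1#
  δℕ-refl u with u ℕ.≟ u
  ... | yes _ = refl
  ... | no ne = ⊥-elim (ne P.refl)

  δℕ-≢ : ∀ u a → a ≢ u → δℕ u a ≈ 0#
  δℕ-≢ u a ne with a ℕ.≟ u
  ... | yes e = ⊥-elim (ne e)
  ... | no _ = refl

  dividesᵇ : ∀ {n} → Vec ℕ n → Vec ℕ n → Bool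
  dividesᵇ [] [] = true
  dividesᵇ (u ∷ us) (k ∷ ks) = if ltb k u then false else dividesᵇ us ks

  ΣF-cong : ∀ {a} {A : Set a} (xs : List A) {f g : A → Carrier} → (∀ x → f x ≈ g x) → ΣF xs f ≈ ΣF xs g
  ΣF-cong [] h = refl
  ΣF-cong (x ∷ xs) h = +-cong (h x) (ΣF-cong xs h)

  ΣF-zero : ∀ {a} {A : Set a} (xs : List A) {f : A → Carrier} → (∀ x → f x ≈ 0#) → ΣF xs f ≈ 0#
  ΣF-zero [] h = refl
  ΣF-zero (x ∷ xs) h = trans (+-cong (h x) (ΣF-zero xs h)) (+-identityˡ 0#)

  ΣF-++ : ∀ {a} {A : Set a} (xs ys : List A) (f : A → Carrier) → ΣF (xs ++ ys) f ≈ (ΣF xs f + ΣF ys f)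
  ΣF-++ [] ys f = sym (+-identityˡ _)
  ΣF-++ (x ∷ xs) ys f = trans (+-congˡ (ΣF-++ xs ys f)) (sym (+-assoc _ _ _))

  ΣF-map : ∀ {a b} {A : Set a} {B : Set b} (h : A → B) (xs : List A) (f : B → Carrier) → ΣF (map h xs) f ≡ ΣF xs (λ x → f (h x))
  ΣF-map h [] f = P.refl
  ΣF-map h (x ∷ xs) f = P.cong (f (h x) +_) (ΣF-map h xs f)

  ΣF-concatMap : ∀ {a b} {A : Set a} {B : Set b} (g : A → List B) (xs : List A) (f : B → Carrier) →
                 ΣF (concatMap g xs) f ≈ ΣF xs (λ x → ΣF (g x) f)
  ΣF-concatMap g [] f = refl
  ΣF-concatMap g (x ∷ xs) f = trans (ΣF-++ (g x) (concatMap g xs) f) (+-congˡ (ΣF-concatMap g xs f))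

  ΣF-*ˡ : ∀ {a} {A : Set a} (xs : List A) (k : Carrier) (f : A → Carrier) → (k * ΣF xs f) ≈ ΣF xs (λ x → k * f x)
  ΣF-*ˡ [] k f = zeroʳ k
  ΣF-*ˡ (x ∷ xs) k f = trans (distribˡ k _ _) (+-congˡ (ΣF-*ˡ xs k f))

  ΣF-applyUpTo : ∀ (h : ℕ → ℕ) k (f : ℕ → Carrier) → ΣF (applyUpTo h k) f ≈ Σ< k (λ i → f (h i))
  ΣF-applyUpTo h zero f = reflexive (P.sym Σ<-zero)
  ΣF-applyUpTo h (suc k) f = trans (+-congˡ (ΣF-applyUpTo (λ i → h (suc i)) k f)) (reflexive (P.sym Σ<-suc))

  ΣF-tabulate : ∀ {a} {A : Set a} k (g : Fin k → A) (f : A → Carrier) (h : ℕ → Carrier) →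
           (∀ j → f (g j) ≈ h (toℕ j)) → ΣF (tabulate g) f ≈ Σ< k h
  ΣF-tabulate zero g f h e = reflexive (P.sym Σ<-zero)
  ΣF-tabulate (suc k) g f h e = trans
      (+-cong (e Fin.zero) (ΣF-tabulate k (λ j → g (Fin.suc j)) f (λ i → h (suc i)) (λ j → e (Fin.suc j))))
                                  (reflexive (P.sym Σ<-suc))

  ΣF-below-δ : ∀ {n} (m u : Monomial n) (g : Monomial n → Carrier) →
         ΣF (below m) (λ a → δ u a * g a) ≈ (if dividesᵇ u m then g u else 0#)
  ΣF-below-δ [] [] g = trans (+-identityʳ _) (*-identityˡ _)
  ΣF-below-δ (k ∷ m) (u0 ∷ us) g = begin
      ΣF (concatMap (λ a → map (a ∷_) (below m)) (upTo (suc k))) (λ a → δ (u0 ∷ us) a * g a)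
    ≈⟨ ΣF-concatMap (λ a → map (a ∷_) (below m)) (upTo (suc k)) _ ⟩
      ΣF (upTo (suc k)) (λ a → ΣF (map (a ∷_) (below m)) (λ a → δ (u0 ∷ us) a * g a))
    ≈⟨ ΣF-cong (upTo (suc k)) (λ a → trans (reflexive (ΣF-map (a ∷_) (below m) _)) (inner a)) ⟩
      ΣF (upTo (suc k)) H
    ≈⟨ ΣF-applyUpTo (λ i → i) (suc k) H ⟩
      Σ< (suc k) H
    ≈⟨ outer ⟩
      (if dividesᵇ (u0 ∷ us) (k ∷ m) then g (u0 ∷ us) else 0#)
    ∎
    where
    H : ℕ → Carrier
    H a = δℕ u0 a * (if dividesᵇ us m then g (a ∷ us) else 0#)
    inner : ∀ a → ΣF (below m) (λ v → δ (u0 ∷ us) (a ∷ v) * g (a ∷ v)) ≈ H a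
    inner a = begin
        ΣF (below m) (λ v → δ (u0 ∷ us) (a ∷ v) * g (a ∷ v))
      ≈⟨ ΣF-cong (below m) (λ v → trans (*-congʳ (δ-cons u0 us a v)) (*-assoc _ _ _)) ⟩
        ΣF (below m) (λ v → δℕ u0 a * (δ us v * g (a ∷ v)))
      ≈⟨ sym (ΣF-*ˡ (below m) (δℕ u0 a) _) ⟩
        (δℕ u0 a * ΣF (below m) (λ v → δ us v * g (a ∷ v)))
      ≈⟨ *-congˡ (ΣF-below-δ m us (λ v → g (a ∷ v))) ⟩
        H a
      ∎
    outer : Σ< (suc k) H ≈ (if dividesᵇ (u0 ∷ us) (k ∷ m) then g (u0 ∷ us) else 0#)
    outer with u0 ℕP.<? suc k
    ... | yes p rewrite ltb-false (ℕP.≤-pred p) = trans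
        (Σ<-single (suc k) u0 p H (λ i _ ne → trans (*-congʳ (δℕ-≢ u0 i ne)) (zeroˡ _)))
                                                   (trans (*-congʳ (δℕ-refl u0)) (*-identityˡ _))
    ... | no p rewrite ltb-true (ℕP.≰⇒> (λ q → p (s≤s q))) =
           Σ<-≈0 (suc k) {H} (λ i pi → trans (*-congʳ (δℕ-≢ u0 i (λ e → p (P.subst (_< suc k) e pi)))) (zeroˡ _))

  ∸0 : ∀ {n} (m : Monomial n) → zipWith _∸_ m (replicate n 0) ≡ m
  ∸0 [] = P.refl
  ∸0 (x ∷ m) = P.cong (x ∷_) (∸0 m)

  dividesᵇ-0 : ∀ {n} (m : Monomial n) → dividesᵇ (replicate n 0) m ≡ true
  dividesᵇ-0 [] = P.refl
  dividesᵇ-0 (x ∷ m) = dividesᵇ-0 m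

  X-*P-coeff : ∀ {n} (i : Fin n) (p : Poly n) m → (X i *P p) m ≈ (if dividesᵇ (unitMon i) m then p (zipWith _∸_ m (unitMon i)) else 0#)
  X-*P-coeff i p m = trans (ΣF-cong (below m) (λ a → *-congʳ (X-coeff i a))) (ΣF-below-δ m (unitMon i) (λ a → p (zipWith _∸_ m a)))

  const-*P-coeff : ∀ {n} (k : Carrier) (p : Poly n) m → (const k *P p) m ≈ (k * p m)
  const-*P-coeff {n} k p m = begin
      ΣF (below m) (λ a → const k a * p (zipWith _∸_ m a))
    ≈⟨ ΣF-cong (below m) (λ a → trans (*-congʳ (const-coeff k a)) (*-assoc _ _ _)) ⟩
      ΣF (below m) (λ a → δ (replicate n 0) a * (k * p (zipWith _∸_ m a)))
    ≈⟨ ΣF-below-δ m (replicate n 0) (λ a → k * p (zipWith _∸_ m a)) ⟩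
      (if dividesᵇ (replicate n 0) m then k * p (zipWith _∸_ m (replicate n 0)) else 0#)
    ≈⟨ reflexive (P.cong (λ b → if b then k * p (zipWith _∸_ m (replicate n 0)) else 0#) (dividesᵇ-0 m)) ⟩
      (k * p (zipWith _∸_ m (replicate n 0)))
    ≈⟨ reflexive (P.cong (λ v → k * p v) (∸0 m)) ⟩
      (k * p m)
    ∎

  0P-coeff : ∀ {n} (m : Monomial n) → 0P m ≈ 0#
  0P-coeff {n} m with ≡-dec ℕ._≟_ m (replicate n 0)
  ... | yes _ = refl
  ... | no _ = refl

  ΣP-coeff : ∀ {n a} {A : Set a} (xs : List A) (f : A → Poly n) m → ΣP xs f m ≈ ΣF xs (λ x → f x m)
  ΣP-coeff [] f m = 0P-coeff m
  ΣP-coeff (x ∷ xs) f m = +-congˡ (ΣP-coeff xs f m)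

  signed-coeff : ∀ {n} b (p : Poly n) m → (if b then p else (-P p)) m ≡ (if b then p m else (- p m))
  signed-coeff true p m = P.refl
  signed-coeff false p m = P.refl

  minorᶠ : ∀ {k} {A : Set c} → (Fin (suc k) → Fin (suc k) → A) → Fin (suc k) → Fin k → Fin k → A
  minorᶠ M j r s = M (Fin.suc r) (punchIn j s)

  -- entryTerm e g m is the coefficient of x^m in ⟦ e ⟧ *P g, and detCoeff M m that of x^m in
  -- det ⟦ M ⟧, expanded along the first row exactly as det is.
  entryTerm : ∀ {n} → Entry n → (Monomial n → Carrier) → Monomial n → Carrier
  entryTerm (var i) g m = if dividesᵇ (unitMon i) m then g (zipWith _∸_ m (unitMon i)) else 0#
  entryTerm (cst a) g m = a * g m

  detCoeff : ∀ {n k} → (Fin k → Fin k → Entry n) → Monomial n → Carrier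
  detCoeff {n} {zero} M m = 1P m
  detCoeff {n} {suc k} M m = ΣF (allFin (suc k)) (λ j → sgn (toℕ j) (entryTerm (M Fin.zero j) (detCoeff (minorᶠ M j)) m))

  entryTerm-cong : ∀ {n} (e : Entry n) {g g' : Monomial n → Carrier} → (∀ m → g m ≈ g' m) → ∀ m → entryTerm e g m ≈ entryTerm e g' m
  entryTerm-cong (var i) h m with dividesᵇ (unitMon i) m
  ... | true = h _
  ... | false = refl
  entryTerm-cong (cst a) h m = *-congˡ (h m)

  det-coeff : ∀ {n k} (M : Fin k → Fin k → Entry n) m → det (λ r s → ⟦ M r s ⟧) m ≈ detCoeff M m
  det-coeff {n} {zero} M m = refl
  det-coeff {n} {suc k} M m = trans (ΣP-coeff (allFin (suc k)) _ m) (ΣF-cong (allFin (suc k)) term)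
    where
    term : ∀ j → (let q = ⟦ M Fin.zero j ⟧ *P det (λ r s → ⟦ minorᶠ M j r s ⟧) in (if evenᵇ (toℕ j) then q else -P q) m)
                 ≈ sgn (toℕ j) (entryTerm (M Fin.zero j) (detCoeff (minorᶠ M j)) m)
    term j = trans (reflexive (signed-coeff (evenᵇ (toℕ j)) (⟦ M Fin.zero j ⟧ *P minorDet) m))
                   (sgn-cong (toℕ j) (trans (entryTerm-coeff (M Fin.zero j))
                       (entryTerm-cong (M Fin.zero j) (det-coeff (minorᶠ M j)) m)))
      where
      minorDet : Poly n
      minorDet = det (λ r s → ⟦ minorᶠ M j r s ⟧)
      entryTerm-coeff : ∀ e → (⟦ e ⟧ *P minorDet) m ≈ entryTerm e minorDet m
      entryTerm-coeff (var i) = X-*P-coeff i minorDet m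
      entryTerm-coeff (cst a) = const-*P-coeff a minorDet m

  lookup-∸0 : ∀ {n} (m : Monomial n) i → lookup (zipWith _∸_ m (replicate n 0)) i ≡ lookup m i
  lookup-∸0 m i = P.cong (λ v → lookup v i) (∸0 m)

  lookup-∸unit-≢ : ∀ {n} (m : Monomial n) (i i' : Fin n) → i ≢ i' → lookup (zipWith _∸_ m (unitMon i')) i ≡ lookup m i
  lookup-∸unit-≢ (x ∷ m) Fin.zero Fin.zero ne = ⊥-elim (ne P.refl)
  lookup-∸unit-≢ (x ∷ m) (Fin.suc i) Fin.zero ne = lookup-∸0 m i
  lookup-∸unit-≢ (x ∷ m) Fin.zero (Fin.suc i') ne = P.refl
  lookup-∸unit-≢ (x ∷ m) (Fin.suc i) (Fin.suc i') ne = lookup-∸unit-≢ m i i' (λ e → ne (P.cong Fin.suc e))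

  lookup-∸unit : ∀ {n} (m : Monomial n) (i : Fin n) → lookup (zipWith _∸_ m (unitMon i)) i ≡ lookup m i ∸ 1
  lookup-∸unit (x ∷ m) Fin.zero = P.refl
  lookup-∸unit (x ∷ m) (Fin.suc i) = lookup-∸unit m i

  dividesᵇ-unit : ∀ {n} (i : Fin n) (m : Monomial n) → dividesᵇ (unitMon i) m ≡ ltb 0 (lookup m i)
  dividesᵇ-unit Fin.zero (zero ∷ m) = P.refl
  dividesᵇ-unit Fin.zero (suc x ∷ m) = dividesᵇ-0 m
  dividesᵇ-unit (Fin.suc i) (x ∷ m) = dividesᵇ-unit i m

  1P-coeff-nonconstant : ∀ {n} (m : Monomial n) (i : Fin n) → 1 ≤ lookup m i → 1P m ≈ 0#
  1P-coeff-nonconstant {n} m i p with ≡-dec ℕ._≟_ m (replicate n 0)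
  ... | yes P.refl = ⊥-elim (ℕP.<⇒≢ p (P.sym (lookup-replicate i 0)))
  ... | no _ = refl

  Avoids : ∀ {n k} → (Fin k → Fin k → Entry n) → Fin n → Set c
  Avoids M i = ∀ r s → M r s ≢ var i

  var-injective : ∀ {n} {i j : Fin n} → var {n} i ≡ var j → i ≡ j
  var-injective P.refl = P.refl

  detCoeff-avoided : ∀ {n k} (M : Fin k → Fin k → Entry n) m i → Avoids M i → 1 ≤ lookup m i → detCoeff M m ≈ 0#
  detCoeff-avoided {n} {zero} M m i ni p = 1P-coeff-nonconstant m i p
  detCoeff-avoided {n} {suc k} M m i ni p = ΣF-zero (allFin (suc k)) term
    where
    term : ∀ j → sgn (toℕ j) (entryTerm (M Fin.zero j) (detCoeff (minorᶠ M j)) m) ≈ 0#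
    term j with M Fin.zero j in eq
    ... | cst a = sgn-zeroʳ (toℕ j) a (detCoeff-avoided (minorᶠ M j) m i (λ r s → ni (Fin.suc r) (punchIn j s)) p)
    ... | var i' with dividesᵇ (unitMon i') m
    ...   | false = sgn-0# (toℕ j)
    ...   | true = trans (sgn-cong (toℕ j) (detCoeff-avoided (minorᶠ M j) _ i (λ r s → ni (Fin.suc r) (punchIn j s))
                      (P.subst (1 ≤_) (P.sym (lookup-∸unit-≢ m i i' (λ e → ni Fin.zero j (P.trans eq (P.cong var (P.sym e)))))) p)))
                        (sgn-0# (toℕ j))

  ReadOnce-minorᶠ : ∀ {n k} (M : Fin (suc k) → Fin (suc k) → Entry n) j → ReadOnce M → ReadOnce (minorᶠ M j)
  ReadOnce-minorᶠ M j ro r s r' s' i e e' with ro (Fin.suc r) (punchIn j s) (Fin.suc r') (punchIn j s') i e e'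
  ... | er , es = FP.suc-injective er , FP.punchIn-injective j s s' es

  detCoeff-nonSquarefree : ∀ {n k} (M : Fin k → Fin k → Entry n) m i → ReadOnce M → 2 ≤ lookup m i → detCoeff M m ≈ 0#
  detCoeff-nonSquarefree {n} {zero} M m i ro p = 1P-coeff-nonconstant m i (ℕP.≤-trans (s≤s z≤n) p)
  detCoeff-nonSquarefree {n} {suc k} M m i ro p = ΣF-zero (allFin (suc k)) term
    where
    term : ∀ j → sgn (toℕ j) (entryTerm (M Fin.zero j) (detCoeff (minorᶠ M j)) m) ≈ 0#
    term j with M Fin.zero j in eq
    ... | cst a = sgn-zeroʳ (toℕ j) a (detCoeff-nonSquarefree (minorᶠ M j) m i (ReadOnce-minorᶠ M j ro) p)
    ... | var i' with dividesᵇ (unitMon i') m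
    ...   | false = sgn-0# (toℕ j)
    ...   | true with i' Fin.≟ i
    ...     | yes P.refl = trans (sgn-cong (toℕ j) (detCoeff-avoided (minorᶠ M j) _ i ni
                              (P.subst (1 ≤_) (P.sym (lookup-∸unit m i)) (ℕP.∸-monoˡ-≤ 1 p)))) (sgn-0# (toℕ j))
      where
      ni : Avoids (minorᶠ M j) i
      ni r s e = FP.0≢1+n (P.sym (proj₁ (ro (Fin.suc r) (punchIn j s) Fin.zero j i e eq)))
    ...     | no ne = trans (sgn-cong (toℕ j) (detCoeff-nonSquarefree (minorᶠ M j) _ i (ReadOnce-minorᶠ M j ro)
                              (P.subst (2 ≤_) (P.sym (lookup-∸unit-≢ m i i' (λ e → ne (P.sym e)))) p))) (sgn-0# (toℕ j))

  all0⇒≡replicate : ∀ {n} (m : Monomial n) → (∀ i → lookup m i ≡ 0) → m ≡ replicate n 0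
  all0⇒≡replicate [] h = P.refl
  all0⇒≡replicate (x ∷ m) h = P.cong₂ _∷_ (h Fin.zero) (all0⇒≡replicate m (λ i → h (Fin.suc i)))

  1P-coeff-constant : ∀ {n} (m : Monomial n) → m ≡ replicate n 0 → 1P m ≈ 1#
  1P-coeff-constant {n} m e with ≡-dec ℕ._≟_ m (replicate n 0)
  ... | yes _ = refl
  ... | no ne = ⊥-elim (ne e)

  lookup-∸unit-≤ : ∀ {n} (m : Monomial n) (i i' : Fin n) → lookup (zipWith _∸_ m (unitMon i)) i' ≤ lookup m i'
  lookup-∸unit-≤ m i i' with i' Fin.≟ i
  ... | yes P.refl rewrite lookup-∸unit m i = ℕP.m∸n≤m _ 1
  ... | no ne rewrite lookup-∸unit-≢ m i' i ne = ℕP.≤-refl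

  cst≢var : ∀ {n} {b : Carrier} {i : Fin n} → cst b ≢ var i
  cst≢var ()

  false≢true : false ≢ true
  false≢true ()

  hits : ∀ {n} → Monomial n → Entry n → Bool
  hits m (var i) = ltb 0 (lookup m i)
  hits m (cst _) = false

  rowHit : ∀ {n k} → Monomial n → (Fin k → Fin k → Entry n) → Fin k → Bool
  rowHit m M r = anyᶠ (λ s → hits m (M r s))

  -- For squarefree x^m, send xᵢ to 1 if it divides x^m and to 0 otherwise; a row containing a
  -- variable that divides x^m contributes that variable to every term of the coefficient, so its
  -- constants are sent to 0.
  specialiseEntry : ∀ {n} → Monomial n → Bool → Entry n → Carrier
  specialiseEntry m h (var i) = if eqb (lookup m i) 1 then 1# else 0#
  specialiseEntry m h (cst a) = if h then 0# else a

  specialise : ∀ {n k} → Monomial n → (Fin k → Fin k → Entry n) → Fin k → Fin k → Carrier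
  specialise m M r s = specialiseEntry m (rowHit m M r) (M r s)

  OneVarPerRow OneVarPerCol : ∀ {n k} → (Fin k → Fin k → Entry n) → Set c
  OneVarPerRow M = ∀ r s s' i i' → M r s ≡ var i → M r s' ≡ var i' → s ≡ s'
  OneVarPerCol M = ∀ r r' s i i' → M r s ≡ var i → M r' s ≡ var i' → r ≡ r'

  OneVarPerRow-minorᶠ : ∀ {n k} (M : Fin (suc k) → Fin (suc k) → Entry n) j → OneVarPerRow M → OneVarPerRow (minorᶠ M j)
  OneVarPerRow-minorᶠ M j h r s s' i i' e e' = FP.punchIn-injective j s s' (h (Fin.suc r) (punchIn j s) (punchIn j s') i i' e e')

  OneVarPerCol-minorᶠ : ∀ {n k} (M : Fin (suc k) → Fin (suc k) → Entry n) j → OneVarPerCol M → OneVarPerCol (minorᶠ M j)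
  OneVarPerCol-minorᶠ M j h r r' s i i' e e' = FP.suc-injective (h (Fin.suc r) (Fin.suc r') (punchIn j s) i i' e e')

  record Specialisable {n k} (M : Fin k → Fin k → Entry n) (m : Monomial n) : Set c where
    field
      readOnce : ReadOnce M
      oneVarPerRow : OneVarPerRow M
      oneVarPerCol : OneVarPerCol M
      squarefree : Squarefree m
      contains : ∀ i → lookup m i ≡ 1 → Σ (Fin k) λ r → Σ (Fin k) λ s → M r s ≡ var i

  SquarefreeCoeff : ℕ → ℕ → Set (c ⊔ ℓ)
  SquarefreeCoeff n k = ∀ (M : Fin k → Fin k → Entry n) m (Z : Matrix) → Specialisable M m →
                        (∀ r s → specialise m M r s ≈ Z (toℕ r) (toℕ s)) → detCoeff M m ≈ detℕ k Z

  detCoeff-squarefree-0 : ∀ {n} → SquarefreeCoeff n 0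
  detCoeff-squarefree-0 M m Z spec _ =
    1P-coeff-constant m (all0⇒≡replicate m (λ i → ≤1∧≢1⇒≡0 (squarefree i) (λ e → noRow (proj₁ (contains i e)))))
    where
    open Specialisable spec
    noRow : Fin 0 → ⊥
    noRow ()

  module _ {n k} (ih : SquarefreeCoeff n k) (M : Fin (suc k) → Fin (suc k) → Entry n) (m : Monomial n) (Z : Matrix)
           (spec : Specialisable M m) (M≈Z : ∀ r s → specialise m M r s ≈ Z (toℕ r) (toℕ s)) where
    open Specialisable spec

    ExpansionTerm : Fin (suc k) → Set ℓ
    ExpansionTerm j = entryTerm (M Fin.zero j) (detCoeff (minorᶠ M j)) m ≈ (Z 0 (toℕ j) * detℕ k (minor (toℕ j) Z))

    Z-row0 : ∀ j → Z 0 (toℕ j) ≈ specialiseEntry m (rowHit m M Fin.zero) (M Fin.zero j)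
    Z-row0 j = sym (M≈Z Fin.zero j)

    Z-minor : ∀ j r s → minor (toℕ j) Z (toℕ r) (toℕ s) ≈ specialiseEntry m (rowHit m M (Fin.suc r)) (minorᶠ M j r s)
    Z-minor j r s = sym (trans (M≈Z (Fin.suc r) (punchIn j s)) (reflexive (P.cong (Z (suc (toℕ r))) (toℕ-punchIn j s))))

    avoids-minor-of-column : ∀ j r i → M (Fin.suc r) j ≡ var i → Avoids (minorᶠ M j) i
    avoids-minor-of-column j r i e r' s e' = FP.punchInᵢ≢i j s (proj₂ (readOnce (Fin.suc r') (punchIn j s) (Fin.suc r) j i e' e))

    avoids-minor-of-row0 : ∀ j j0 i → M Fin.zero j0 ≡ var i → Avoids (minorᶠ M j) i
    avoids-minor-of-row0 j j0 i e r' s e' = FP.0≢1+n (P.sym (proj₁ (readOnce (Fin.suc r') (punchIn j s) Fin.zero j0 i e' e)))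

    contains-minor : ∀ j (m' : Monomial n) → (∀ i → lookup m' i ≡ 1 → lookup m i ≡ 1) →
      (∀ s i → lookup m' i ≡ 1 → M Fin.zero s ≢ var i) → (∀ r i → lookup m' i ≡ 1 → M (Fin.suc r) j ≢ var i) →
      ∀ i → lookup m' i ≡ 1 → Σ (Fin k) λ r → Σ (Fin k) λ s → minorᶠ M j r s ≡ var i
    contains-minor j m' m'⊆m notRow0 notCol i m'-i≡1 with contains i (m'⊆m i m'-i≡1)
    ... | Fin.zero , s , eM = ⊥-elim (notRow0 s i m'-i≡1 eM)
    ... | Fin.suc r , s , eM with s Fin.≟ j
    ...   | yes P.refl = ⊥-elim (notCol r i m'-i≡1 eM)
    ...   | no s≢j = r , Fin.punchOut (λ e → s≢j (P.sym e)) , P.trans (P.cong (M (Fin.suc r)) (FP.punchIn-punchOut _)) eM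

    -- Row 0 holds xᵢ with mᵢ = 1: only the term of its column survives, with xᵢ divided out.
    expansionTerm-hitRow : ∀ j0 i → M Fin.zero j0 ≡ var i → lookup m i ≡ 1 → ∀ j → ExpansionTerm j
    expansionTerm-hitRow j0 i e0 m-i≡1 j with j Fin.≟ j0
    ... | no j≢j0 with M Fin.zero j in ej
    ...   | var i' = ⊥-elim (j≢j0 (oneVarPerRow Fin.zero j j0 i' i ej e0))
    ...   | cst a =
      trans (*-congˡ (detCoeff-avoided (minorᶠ M j) m i (avoids-minor-of-row0 j j0 i e0) (P.subst (1 ≤_) (P.sym m-i≡1) ℕP.≤-refl)))
            (trans (zeroʳ a) (sym (trans (*-congʳ Z0j≈0) (zeroˡ _))))
      where
      row0Hit : rowHit m M Fin.zero ≡ true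
      row0Hit = anyᶠ-true (λ s → hits m (M Fin.zero s)) j0 (P.trans (P.cong (hits m) e0) (P.cong (ltb 0) m-i≡1))
      Z0j≈0 : Z 0 (toℕ j) ≈ 0#
      Z0j≈0 = trans (Z-row0 j) (reflexive (P.trans (P.cong (specialiseEntry m (rowHit m M Fin.zero)) ej)
                                                   (P.cong (λ b → if b then 0# else a) row0Hit)))
    expansionTerm-hitRow j0 i e0 m-i≡1 j | yes P.refl rewrite e0 | dividesᵇ-unit i m | m-i≡1 =
      trans (ih (minorᶠ M j) m' (minor (toℕ j) Z) spec' specialise≈) (sym (trans (*-congʳ Z0j≈1) (*-identityˡ _)))
      where
      m' : Monomial n
      m' = zipWith _∸_ m (unitMon i)
      Z0j≈1 : Z 0 (toℕ j) ≈ 1#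
      Z0j≈1 = trans (Z-row0 j) (reflexive (P.trans (P.cong (specialiseEntry m (rowHit m M Fin.zero)) e0)
                                                   (P.cong (λ x → if eqb x 1 then 1# else 0#) m-i≡1)))
      ≢i : ∀ r s i'' → minorᶠ M j r s ≡ var i'' → i'' ≢ i
      ≢i r s i'' e P.refl = avoids-minor-of-row0 j j i e0 r s e
      m'≡m : ∀ i'' → i'' ≢ i → lookup m' i'' ≡ lookup m i''
      m'≡m i'' ne = lookup-∸unit-≢ m i'' i ne
      m'-i≢1 : lookup m' i ≢ 1
      m'-i≢1 e = ℕP.1+n≢0 (P.trans (P.sym e) (P.trans (lookup-∸unit m i) (P.cong (_∸ 1) m-i≡1)))
      m'⊆m : ∀ i' → lookup m' i' ≡ 1 → lookup m i' ≡ 1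
      m'⊆m i' e with i' Fin.≟ i
      ... | yes P.refl = ⊥-elim (m'-i≢1 e)
      ... | no ne = P.trans (P.sym (m'≡m i' ne)) e
      notRow0 : ∀ s i' → lookup m' i' ≡ 1 → M Fin.zero s ≢ var i'
      notRow0 s i' e eM with oneVarPerRow Fin.zero s j i' i eM e0
      ... | P.refl = m'-i≢1 (P.subst (λ z → lookup m' z ≡ 1) (var-injective (P.trans (P.sym eM) e0)) e)
      columnFree : ∀ r i' → M (Fin.suc r) j ≢ var i'
      columnFree r i' eM = FP.0≢1+n (oneVarPerCol Fin.zero (Fin.suc r) j i i' e0 eM)
      spec' : Specialisable (minorᶠ M j) m'
      spec' = record
        { readOnce = ReadOnce-minorᶠ M j readOnce
        ; oneVarPerRow = OneVarPerRow-minorᶠ M j oneVarPerRow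
        ; oneVarPerCol = OneVarPerCol-minorᶠ M j oneVarPerCol
        ; squarefree = λ i' → ℕP.≤-trans (lookup-∸unit-≤ m i i') (squarefree i')
        ; contains = contains-minor j m' m'⊆m notRow0 (λ r i' _ → columnFree r i')
        }
      sameEntry : ∀ r s h → (hits m' (minorᶠ M j r s) ≡ hits m (minorᶠ M j r s)) ×
                            (specialiseEntry m' h (minorᶠ M j r s) ≡ specialiseEntry m h (minorᶠ M j r s))
      sameEntry r s h with minorᶠ M j r s in eq
      ... | cst a = P.refl , P.refl
      ... | var i'' = P.cong (ltb 0) (m'≡m i'' (≢i r s i'' eq)) ,
                      P.cong (λ x → if eqb x 1 then 1# else 0#) (m'≡m i'' (≢i r s i'' eq))
      columnUnhit : ∀ r → hits m (M (Fin.suc r) j) ≡ false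
      columnUnhit r with M (Fin.suc r) j in eq
      ... | cst a = P.refl
      ... | var i'' = ⊥-elim (columnFree r i'' eq)
      sameRowHit : ∀ r → rowHit m' (minorᶠ M j) r ≡ rowHit m M (Fin.suc r)
      sameRowHit r = P.trans (anyᶠ-cong _ _ (λ s → proj₁ (sameEntry r s true)))
                             (P.sym (P.trans (anyᶠ-punchIn (λ s → hits m (M (Fin.suc r) s)) j)
                                             (P.cong (λ b → if b then true else rowHit m (minorᶠ M j) r) (columnUnhit r))))
      specialise≈ : ∀ r s → specialise m' (minorᶠ M j) r s ≈ minor (toℕ j) Z (toℕ r) (toℕ s)
      specialise≈ r s = trans (reflexive (P.trans (P.cong (λ h → specialiseEntry m' h (minorᶠ M j r s)) (sameRowHit r))
                                                  (proj₂ (sameEntry r s _))))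
                              (sym (Z-minor j r s))

    -- No variable of row 0 divides x^m: the variables of row 0 contribute nothing, the constants
    -- keep their value, and the minors are handled as in the specialised matrix.
    detCoeff-minor-unhitRow : (∀ j → hits m (M Fin.zero j) ≡ false) → ∀ j →
                              detCoeff (minorᶠ M j) m ≈ detℕ k (minor (toℕ j) Z)
    detCoeff-minor-unhitRow row0Unhit j with findᶠ (λ r → hits m (M (Fin.suc r) j))
    ... | inj₁ (r , hit) with M (Fin.suc r) j in er
    ...   | cst _ = ⊥-elim (false≢true hit)
    ...   | var i =
      trans (detCoeff-avoided (minorᶠ M j) m i (avoids-minor-of-column j r i er) (ltb0⇒1≤ hit))
            (sym (detℕ-zeroRow k (toℕ r) (FP.toℕ<n r) zeroRow))
      where
      rowHitR : rowHit m M (Fin.suc r) ≡ true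
      rowHitR = anyᶠ-true (λ s → hits m (M (Fin.suc r) s)) j (P.trans (P.cong (hits m) er) hit)
      zeroEntry : ∀ s → specialiseEntry m (rowHit m M (Fin.suc r)) (minorᶠ M j r s) ≈ 0#
      zeroEntry s with minorᶠ M j r s in ee
      ... | var i' = ⊥-elim (FP.punchInᵢ≢i j s (oneVarPerRow (Fin.suc r) (punchIn j s) j i' i ee er))
      ... | cst b = reflexive (P.cong (λ x → if x then 0# else b) rowHitR)
      zeroRow : ∀ s → s < k → minor (toℕ j) Z (toℕ r) s ≈ 0#
      zeroRow s s<k = trans (reflexive (P.cong (minor (toℕ j) Z (toℕ r)) (P.sym (FP.toℕ-fromℕ< s<k))))
                            (trans (Z-minor j r (Fin.fromℕ< s<k)) (zeroEntry (Fin.fromℕ< s<k)))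
    detCoeff-minor-unhitRow row0Unhit j | inj₂ columnUnhit = ih (minorᶠ M j) m (minor (toℕ j) Z) spec' specialise≈
      where
      unhit⇒≢1 : ∀ {e} i → hits m e ≡ false → e ≡ var i → lookup m i ≢ 1
      unhit⇒≢1 i h P.refl e = false≢true (P.trans (P.sym h) (P.cong (ltb 0) e))
      spec' : Specialisable (minorᶠ M j) m
      spec' = record
        { readOnce = ReadOnce-minorᶠ M j readOnce
        ; oneVarPerRow = OneVarPerRow-minorᶠ M j oneVarPerRow
        ; oneVarPerCol = OneVarPerCol-minorᶠ M j oneVarPerCol
        ; squarefree = squarefree
        ; contains = contains-minor j m (λ _ e → e) (λ s i e eM → unhit⇒≢1 i (row0Unhit s) eM e)
                                                    (λ r i e eM → unhit⇒≢1 i (columnUnhit r) eM e)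
        }
      sameRowHit : ∀ r → rowHit m (minorᶠ M j) r ≡ rowHit m M (Fin.suc r)
      sameRowHit r = P.sym (P.trans (anyᶠ-punchIn (λ s → hits m (M (Fin.suc r) s)) j)
                                    (P.cong (λ b → if b then true else rowHit m (minorᶠ M j) r) (columnUnhit r)))
      specialise≈ : ∀ r s → specialise m (minorᶠ M j) r s ≈ minor (toℕ j) Z (toℕ r) (toℕ s)
      specialise≈ r s = trans (reflexive (P.cong (λ h → specialiseEntry m h (minorᶠ M j r s)) (sameRowHit r)))
                              (sym (Z-minor j r s))

    expansionTerm-unhitRow : (∀ j → hits m (M Fin.zero j) ≡ false) → ∀ j → ExpansionTerm j
    expansionTerm-unhitRow row0Unhit j with M Fin.zero j in ej
    ... | var i rewrite dividesᵇ-unit i m =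
      trans (reflexive (P.cong (λ b → if b then detCoeff (minorᶠ M j) (zipWith _∸_ m (unitMon i)) else 0#) m-i≡0))
            (sym (trans (*-congʳ Z0j≈0) (zeroˡ _)))
      where
      m-i≡0 : ltb 0 (lookup m i) ≡ false
      m-i≡0 = P.trans (P.sym (P.cong (hits m) ej)) (row0Unhit j)
      Z0j≈0 : Z 0 (toℕ j) ≈ 0#
      Z0j≈0 = trans (Z-row0 j) (reflexive (P.trans (P.cong (specialiseEntry m (rowHit m M Fin.zero)) ej)
                                                   (P.cong (λ x → if eqb x 1 then 1# else 0#) (ltb0-false {lookup m i} m-i≡0))))
    ... | cst a = trans (*-congˡ (detCoeff-minor-unhitRow row0Unhit j)) (sym (*-congʳ Z0j≈a))
      where
      Z0j≈a : Z 0 (toℕ j) ≈ a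
      Z0j≈a = trans (Z-row0 j) (reflexive (P.trans (P.cong (specialiseEntry m (rowHit m M Fin.zero)) ej)
                                                   (P.cong (λ b → if b then 0# else a) (anyᶠ-false _ row0Unhit))))

    expansionTerm : ∀ j → ExpansionTerm j
    expansionTerm j with findᶠ (λ j → hits m (M Fin.zero j))
    ... | inj₂ row0Unhit = expansionTerm-unhitRow row0Unhit j
    ... | inj₁ (j0 , hit) with M Fin.zero j0 in e0
    ...   | cst _ = ⊥-elim (false≢true hit)
    ...   | var i = expansionTerm-hitRow j0 i e0 (ltb0∧≤1⇒≡1 hit (squarefree i)) j

  detCoeff-squarefree : ∀ {n} k → SquarefreeCoeff n k
  detCoeff-squarefree zero = detCoeff-squarefree-0
  detCoeff-squarefree (suc k) M m Z spec M≈Z =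
    ΣF-tabulate (suc k) (λ j → j) (λ j → sgn (toℕ j) (entryTerm (M Fin.zero j) (detCoeff (minorᶠ M j)) m))
                (λ j → sgn j (Z 0 j * detℕ k (minor j Z)))
                (λ j → sgn-cong (toℕ j) (expansionTerm (detCoeff-squarefree k) M m Z spec M≈Z j))

  addUnit : ∀ {n} → Fin n → Vec ℕ n → Vec ℕ n
  addUnit Fin.zero (a ∷ v) = suc a ∷ v
  addUnit (Fin.suc x) (a ∷ v) = a ∷ addUnit x v

  addUnit-∸unit : ∀ {n} (x : Fin n) (v : Vec ℕ n) → zipWith _∸_ (addUnit x v) (unitMon x) ≡ v
  addUnit-∸unit Fin.zero (a ∷ v) = P.cong (a ∷_) (∸0 v)
  addUnit-∸unit (Fin.suc x) (a ∷ v) = P.cong (a ∷_) (addUnit-∸unit x v)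

  ∸unit-addUnit : ∀ {n} (x : Fin n) (m : Vec ℕ n) → 1 ≤ lookup m x → addUnit x (zipWith _∸_ m (unitMon x)) ≡ m
  ∸unit-addUnit Fin.zero (suc a ∷ m) _ = P.cong (suc a ∷_) (∸0 m)
  ∸unit-addUnit (Fin.suc x) (a ∷ m) p = P.cong (a ∷_) (∸unit-addUnit x m p)

  lookup-addUnit : ∀ {n} (x : Fin n) (v : Vec ℕ n) → lookup (addUnit x v) x ≡ suc (lookup v x)
  lookup-addUnit Fin.zero (a ∷ v) = P.refl
  lookup-addUnit (Fin.suc x) (a ∷ v) = lookup-addUnit x v

  lookup-addUnit-≢ : ∀ {n} (x y : Fin n) (v : Vec ℕ n) → y ≢ x → lookup (addUnit y v) x ≡ lookup v x
  lookup-addUnit-≢ Fin.zero Fin.zero v ne = ⊥-elim (ne P.refl)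
  lookup-addUnit-≢ Fin.zero (Fin.suc y) (a ∷ v) ne = P.refl
  lookup-addUnit-≢ (Fin.suc x) Fin.zero (a ∷ v) ne = P.refl
  lookup-addUnit-≢ (Fin.suc x) (Fin.suc y) (a ∷ v) ne = lookup-addUnit-≢ x y v (λ e → ne (P.cong Fin.suc e))

  δ-≡ : ∀ {n} (u a : Monomial n) → a ≡ u → δ u a ≈ 1#
  δ-≡ u a P.refl = δ-refl u

  δ-shift : ∀ {n} (x : Fin n) (v m : Monomial n) → lookup v x ≡ 0 →
            (if dividesᵇ (unitMon x) m then δ v (zipWith _∸_ m (unitMon x)) else 0#) ≈ δ (addUnit x v) m
  δ-shift x v m v0 rewrite dividesᵇ-unit x m with lookup m x in lmx
  ... | zero = sym (δ-≢ (addUnit x v) m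
      (λ e → ℕP.0≢1+n (P.trans (P.sym lmx) (P.trans (P.cong (λ w → lookup w x) e) (lookup-addUnit x v)))))
  ... | suc _ = byDecision (≡-dec ℕ._≟_ (zipWith _∸_ m (unitMon x)) v)
    where
    byDecision : Dec (zipWith _∸_ m (unitMon x) ≡ v) → δ v (zipWith _∸_ m (unitMon x)) ≈ δ (addUnit x v) m
    byDecision (yes e) = trans (δ-≡ v _ e)
        (sym (δ-≡ (addUnit x v) m (P.trans (P.sym (∸unit-addUnit x m (P.subst (1 ≤_) (P.sym lmx) (s≤s z≤n)))) (P.cong (addUnit x) e))))
    byDecision (no ne) = trans (δ-≢ v _ ne)
        (sym (δ-≢ (addUnit x v) m (λ e → ne (P.trans (P.cong (λ w → zipWith _∸_ w (unitMon x)) e) (addUnit-∸unit x v)))))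

  monomialOf : ∀ {n} → Vec Bool n → List (Fin n) → Monomial n
  monomialOf {n} B [] = replicate n 0
  monomialOf B (x ∷ L) = if lookup B x then addUnit x (monomialOf B L) else monomialOf B L

  lookup-monomialOf-∉ : ∀ {n k} (B : Vec Bool n) (g : Fin k → Fin n) x → (∀ j → g j ≢ x) → lookup (monomialOf B (tabulate g)) x ≡ 0
  lookup-monomialOf-∉ {k = zero} B g x h = lookup-replicate x 0
  lookup-monomialOf-∉ {k = suc k} B g x h with lookup B (g Fin.zero)
  ... | true = P.trans (lookup-addUnit-≢ x (g Fin.zero) _ (h Fin.zero))
      (lookup-monomialOf-∉ B (λ j → g (Fin.suc j)) x (λ j → h (Fin.suc j)))
  ... | false = lookup-monomialOf-∉ B (λ j → g (Fin.suc j)) x (λ j → h (Fin.suc j))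

  ΠP-vars-coeff : ∀ {n k} (B : Vec Bool n) (g : Fin k → Fin n) → (∀ a b → g a ≡ g b → a ≡ b) → ∀ m →
         ΠP (tabulate g) (λ i → if lookup B i then X i else 1P) m ≈ δ (monomialOf B (tabulate g)) m
  ΠP-vars-coeff {n} {zero} B g inj m = trans (const-coeff 1# m) (*-identityʳ _)
  ΠP-vars-coeff {n} {suc k} B g inj m with lookup B (g Fin.zero)
  ... | true = begin
        (X x *P p) m
      ≈⟨ X-*P-coeff x p m ⟩
        (if dividesᵇ (unitMon x) m then p (zipWith _∸_ m (unitMon x)) else 0#)
      ≈⟨ reflexive (P.cong (λ b → if b then p (zipWith _∸_ m (unitMon x)) else 0#) (dividesᵇ-unit x m)) ⟩
        (if ltb 0 (lookup m x) then p (zipWith _∸_ m (unitMon x)) else 0#)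
      ≈⟨ underIf (ltb 0 (lookup m x)) ⟩
        (if ltb 0 (lookup m x) then δ v (zipWith _∸_ m (unitMon x)) else 0#)
      ≈⟨ reflexive (P.cong (λ b → if b then δ v (zipWith _∸_ m (unitMon x)) else 0#) (P.sym (dividesᵇ-unit x m))) ⟩
        (if dividesᵇ (unitMon x) m then δ v (zipWith _∸_ m (unitMon x)) else 0#)
      ≈⟨ δ-shift x v m (lookup-monomialOf-∉ B (λ j → g (Fin.suc j)) x (λ j e → FP.0≢1+n (inj _ _ (P.sym e)))) ⟩
        δ (addUnit x v) m
      ∎
    where
    x : Fin n
    x = g Fin.zero
    p : Poly n
    p = ΠP (tabulate (λ j → g (Fin.suc j))) (λ i → if lookup B i then X i else 1P)
    v : Monomial n
    v = monomialOf B (tabulate (λ j → g (Fin.suc j)))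
    ih : ∀ m' → p m' ≈ δ v m'
    ih = ΠP-vars-coeff B (λ j → g (Fin.suc j)) (λ a b e → FP.suc-injective (inj _ _ e))
    underIf : ∀ b → (if b then p (zipWith _∸_ m (unitMon x)) else 0#) ≈ (if b then δ v (zipWith _∸_ m (unitMon x)) else 0#)
    underIf true = ih _
    underIf false = refl
  ... | false = trans (const-*P-coeff 1# (ΠP (tabulate (λ j → g (Fin.suc j))) (λ i → if lookup B i then X i else 1P)) m)
      (trans (*-identityˡ _) (ΠP-vars-coeff B (λ j → g (Fin.suc j)) (λ a b e → FP.suc-injective (inj _ _ e)) m))

  monomialOf-suc : ∀ {n k} b (B : Vec Bool n) (g : Fin k → Fin n) → monomialOf (b ∷ B)
      (tabulate (λ j → Fin.suc (g j))) ≡ 0 ∷ monomialOf B (tabulate g)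
  monomialOf-suc {k = zero} b B g = P.refl
  monomialOf-suc {k = suc k} b B g with lookup B (g Fin.zero)
  ... | true = P.cong (addUnit (Fin.suc (g Fin.zero))) (monomialOf-suc b B (λ j → g (Fin.suc j)))
  ... | false = monomialOf-suc b B (λ j → g (Fin.suc j))

  boolsToMonomial : ∀ {n} → Vec Bool n → Monomial n
  boolsToMonomial [] = []
  boolsToMonomial (b ∷ B) = boolToℕ b ∷ boolsToMonomial B

  monomialOf-allFin : ∀ {n} (B : Vec Bool n) → monomialOf B (allFin n) ≡ boolsToMonomial B
  monomialOf-allFin [] = P.refl
  monomialOf-allFin (true ∷ B) = P.cong (addUnit Fin.zero)
      (P.trans (monomialOf-suc true B (λ j → j)) (P.cong (0 ∷_) (monomialOf-allFin B)))
  monomialOf-allFin (false ∷ B) = P.trans (monomialOf-suc false B (λ j → j)) (P.cong (0 ∷_) (monomialOf-allFin B))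

  prodVars-coeff : ∀ {n} (B : Vec Bool n) m → prodVars B m ≈ δ (boolsToMonomial B) m
  prodVars-coeff {n} B m = trans (ΠP-vars-coeff B (λ j → j) (λ a b e → e) m) (reflexive (P.cong (λ v → δ v m) (monomialOf-allFin B)))

  if-0P-coeff : ∀ {n} b (p : Poly n) m → (if b then p else 0P) m ≈ (if b then p m else 0#)
  if-0P-coeff true p m = refl
  if-0P-coeff false p m = 0P-coeff m

  ΣF-map-+ : ∀ {a} {A B : Set a} (h1 h2 : A → B) (xs : List A) (f : B → Carrier) →
             ΣF (map h1 xs ++ map h2 xs) f ≈ (ΣF xs (λ x → f (h1 x)) + ΣF xs (λ x → f (h2 x)))
  ΣF-map-+ h1 h2 xs f = trans (ΣF-++ (map h1 xs) (map h2 xs) f) (+-cong (reflexive (ΣF-map h1 xs f)) (reflexive (ΣF-map h2 xs f)))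

  ΣF-subsets-δ : ∀ n d (m : Monomial n) → ΣF (subsets n) (λ B → if size B ℕ.≡ᵇ d then δ (boolsToMonomial B) m else 0#) ≈
      (if isSubsetOfSize d m then 1# else 0#)
  ΣF-subsets-δ zero zero [] = trans (+-identityʳ _) (δ-refl [])
  ΣF-subsets-δ zero (suc d) [] = +-identityʳ _
  ΣF-subsets-δ (suc n) d (x ∷ m) = trans (ΣF-map-+ (true ∷_) (false ∷_) (subsets n) _)
      (trans (+-cong sumWithFirst sumWithoutFirst) (combine x d))
    where
    withFirst : Vec Bool n → Carrier
    withFirst B = if suc (size B) ℕ.≡ᵇ d then δ (boolsToMonomial B) m else 0#
    withoutFirst : Vec Bool n → Carrier
    withoutFirst B = if size B ℕ.≡ᵇ d then δ (boolsToMonomial B) m else 0#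
    δ-split : ∀ b u (v : Vec ℕ n) → (if b then δ (u ∷ v) (x ∷ m) else 0#) ≈ (δℕ u x * (if b then δ v m else 0#))
    δ-split true u v = δ-cons u v x m
    δ-split false u v = sym (zeroʳ _)
    sumWithFirst : ΣF (subsets n) (λ B → if size (true ∷ B) ℕ.≡ᵇ d then δ (boolsToMonomial (true ∷ B)) (x ∷ m) else 0#) ≈
        (δℕ 1 x * ΣF (subsets n) withFirst)
    sumWithFirst = trans (ΣF-cong (subsets n) (λ B → δ-split (suc (size B) ℕ.≡ᵇ d) 1 (boolsToMonomial B)))
        (sym (ΣF-*ˡ (subsets n) (δℕ 1 x) withFirst))
    sumWithoutFirst : ΣF (subsets n)
        (λ B → if size (false ∷ B) ℕ.≡ᵇ d then δ (boolsToMonomial (false ∷ B)) (x ∷ m) else 0#) ≈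
            (δℕ 0 x * ΣF (subsets n) withoutFirst)
    sumWithoutFirst = trans (ΣF-cong (subsets n) (λ B → δ-split (size B ℕ.≡ᵇ d) 0 (boolsToMonomial B)))
        (sym (ΣF-*ˡ (subsets n) (δℕ 0 x) withoutFirst))
    combine : ∀ x d → ((δℕ 1 x * ΣF (subsets n) (λ B → if suc (size B) ℕ.≡ᵇ d then δ (boolsToMonomial B) m else 0#)) +
                   (δℕ 0 x * ΣF (subsets n) (λ B → if size B ℕ.≡ᵇ d then δ (boolsToMonomial B) m else 0#)))
                  ≈ (if isSubsetOfSize d (x ∷ m) then 1# else 0#)
    combine zero d = trans (+-cong (trans (*-congʳ (δℕ-≢ 1 0 (λ ()))) (zeroˡ _)) (trans (*-congʳ (δℕ-refl 0)) (*-identityˡ _)))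
                       (trans (+-identityˡ _) (ΣF-subsets-δ n d m))
    combine (suc zero) zero = trans (+-cong (trans (*-congˡ (ΣF-zero (subsets n) (λ _ → refl))) (zeroʳ _))
                                       (trans (*-congʳ (δℕ-≢ 0 1 (λ ()))) (zeroˡ _))) (+-identityˡ _)
    combine (suc zero) (suc d) = trans
        (+-cong (trans (*-congʳ (δℕ-refl 1)) (*-identityˡ _)) (trans (*-congʳ (δℕ-≢ 0 1 (λ ()))) (zeroˡ _)))
                                   (trans (+-identityʳ _) (ΣF-subsets-δ n d m))
    combine (suc (suc y)) zero = trans
        (+-cong (trans (*-congʳ (δℕ-≢ 1 (suc (suc y)) (λ ()))) (zeroˡ _))
            (trans (*-congʳ (δℕ-≢ 0 (suc (suc y)) (λ ()))) (zeroˡ _))) (+-identityˡ _)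
    combine (suc (suc y)) (suc d) = trans
        (+-cong (trans (*-congʳ (δℕ-≢ 1 (suc (suc y)) (λ ()))) (zeroˡ _))
            (trans (*-congʳ (δℕ-≢ 0 (suc (suc y)) (λ ()))) (zeroˡ _))) (+-identityˡ _)

  S-coeff : ∀ n d (m : Monomial n) → S n d m ≈ (if isSubsetOfSize d m then 1# else 0#)
  S-coeff n d m = trans (ΣP-coeff (subsets n) _ m)
                  (trans (ΣF-cong (subsets n) (λ B → trans (if-0P-coeff (size B ℕ.≡ᵇ d) (prodVars B) m) (underIf (size B ℕ.≡ᵇ d) B)))
                         (ΣF-subsets-δ n d m))
    where
    underIf : ∀ b B → (if b then prodVars B m else 0#) ≈ (if b then δ (boolsToMonomial B) m else 0#)
    underIf true B = prodVars-coeff B m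
    underIf false B = refl

  S-coeff≉0⇔ : ∀ n d (m : Monomial n) → Squarefree m → (m ∈mon S n d) ⇔ (weight m ≡ d)
  S-coeff≉0⇔ n d m m-sqf = mk⇔ to from
    where
    to : m ∈mon S n d → weight m ≡ d
    to m∈ with isSubsetOfSize d m in e
    ... | true = isSubsetOfSize-sound d m m-sqf e
    ... | false = ⊥-elim (m∈ (trans (S-coeff n d m) (reflexive (P.cong (λ b → if b then 1# else 0#) e))))
    from : weight m ≡ d → m ∈mon S n d
    from w≡d e = 1≉0 (trans (reflexive (P.cong (λ b → if b then 1# else 0#) (P.sym sub))) (trans (sym (S-coeff n d m)) e))
      where
      sub : isSubsetOfSize d m ≡ true
      sub = isSubsetOfSize-complete d m m-sqf w≡d

  S-coeff-nonSquarefree : ∀ n d (m : Monomial n) i → 2 ≤ lookup m i → S n d m ≈ 0#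
  S-coeff-nonSquarefree n d m i m-i≥2 =
    trans (S-coeff n d m) (reflexive (P.cong (λ b → if b then 1# else 0#) (isSubsetOfSize-nonSquarefree d m i m-i≥2)))
module Construction {c ℓ} (F : Field c ℓ) where
  open Field F hiding (zero)
  open PolyRing F
  open Determinant F
  open Coefficients F
  open import Algebra.Definitions.RawSemiring (Semiring.rawSemiring semiring) using (_^_)

  -- The matrix of the construction after the substitution xᵢ ↦ 1 (i ∈ A), xᵢ ↦ 0 (i ∉ A),
  -- with the rows i ∈ A then turned into unit rows.
  specialised : ℕ → ℕ → (ℕ → Carrier) → (ℕ → Bool) → Matrix
  specialised n r a A i j =
    if ltb i n
    then (if ltb j n then (if eqb i j then (if A i then 1# else 0#) else 0#)
          else (if A i then 0# else a i ^ (j ∸ n)))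
    else (if ltb j n then a j ^ (i ∸ n) else 0#)

  specialised-minor : ∀ n r a A i x y → i ≤ n →
    specialised (suc n) r a A (punchInℕ i x) (punchInℕ i y) ≈
    specialised n r (λ z → a (punchInℕ i z)) (λ z → A (punchInℕ i z)) x y
  specialised-minor n r a A i x y p
    rewrite ltb-punchInℕ i n x p | ltb-punchInℕ i n y p | eqb-punchInℕ i x y with x ℕP.<? n | y ℕP.<? n
  ... | yes px | yes py rewrite ltb-true px | ltb-true py = refl
  ... | yes px | no py rewrite ltb-true px | ltb-false (ℕP.≮⇒≥ py) | ∸-punchInℕ i n y p (ℕP.≮⇒≥ py) = refl
  ... | no px | yes py rewrite ltb-false (ℕP.≮⇒≥ px) | ltb-true py | ∸-punchInℕ i n x p (ℕP.≮⇒≥ px) = refl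
  ... | no px | no py rewrite ltb-false (ℕP.≮⇒≥ px) | ltb-false (ℕP.≮⇒≥ py) = refl

  detℕ-specialised-deleteUnitRow : ∀ n r a A i → i < suc n → A i ≡ true →
    detℕ (suc n ℕ.+ r) (specialised (suc n) r a A) ≈
    sgn (i ℕ.+ i) (detℕ (n ℕ.+ r) (specialised n r (λ z → a (punchInℕ i z)) (λ z → A (punchInℕ i z))))
  detℕ-specialised-deleteUnitRow n r a A i i<n Ai =
    trans (detℕ-unitRow (n ℕ.+ r) i i {specialised (suc n) r a A} i<n+r i<n+r offDiagonal)
          (sgn-cong (i ℕ.+ i) (trans (*-cong diagonal (detℕ-cong (n ℕ.+ r) minor≈)) (*-identityˡ _)))
    where
    i<n+r : i < suc (n ℕ.+ r)
    i<n+r = ℕP.≤-trans i<n (s≤s (ℕP.m≤m+n n r))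
    offDiagonal : ∀ s → s < suc (n ℕ.+ r) → s ≢ i → specialised (suc n) r a A i s ≈ 0#
    offDiagonal s _ s≢i rewrite ltb-true i<n | Ai with ltb s (suc n)
    ... | true rewrite eqb-false (λ e → s≢i (P.sym e)) = refl
    ... | false = refl
    diagonal : specialised (suc n) r a A i i ≈ 1#
    diagonal rewrite ltb-true i<n | eqb-refl i | Ai = refl
    minor≈ : ∀ x y → x < n ℕ.+ r → y < n ℕ.+ r →
             specialised (suc n) r a A (punchInℕ i x) (punchInℕ i y) ≈
             specialised n r (λ z → a (punchInℕ i z)) (λ z → A (punchInℕ i z)) x y
    minor≈ x y _ _ = specialised-minor n r a A i x y (ℕP.≤-pred i<n)

  -- With A = ∅ the matrix is [[0, V], [W, 0]] with an n × r block V.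
  detℕ-specialised∅-nonsquare : ∀ n r a A → (∀ i → i < n → A i ≡ false) → n ≢ r →
                                detℕ (n ℕ.+ r) (specialised n r a A) ≈ 0#
  detℕ-specialised∅-nonsquare n r a A A∅ n≢r with ℕP.<-cmp n r
  ... | tri≈ _ n≡r _ = ⊥-elim (n≢r n≡r)
  ... | tri< n<r _ _ =
    detℕ-zeroBlock (n ℕ.+ r) (λ i → not (ltb i n)) (λ j → ltb j n) lowerLeftOnly
      (P.subst₂ _<_ (P.sym (count<-ltb n r)) (P.sym (count<-not-ltb n r)) n<r)
    where
    lowerLeftOnly : ∀ i j → i < n ℕ.+ r → j < n ℕ.+ r → not (ltb i n) ≡ true → ltb j n ≡ false →
                    specialised n r a A i j ≈ 0#
    lowerLeftOnly i j _ _ ei ej with ltb i n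
    lowerLeftOnly i j _ _ () ej | true
    ... | false rewrite ej = refl
  ... | tri> _ _ r<n =
    detℕ-zeroBlock (n ℕ.+ r) (λ i → ltb i n) (λ j → not (ltb j n)) upperRightOnly
      (P.subst₂ _<_ (P.sym (count<-not-ltb n r)) (P.sym (count<-ltb n r)) r<n)
    where
    upperRightOnly : ∀ i j → i < n ℕ.+ r → j < n ℕ.+ r → ltb i n ≡ true → not (ltb j n) ≡ false →
                     specialised n r a A i j ≈ 0#
    upperRightOnly i j _ _ ei ej with ltb j n
    upperRightOnly i j _ _ ei () | false
    ... | true rewrite ei | A∅ i (ltb⇒< ei) with eqb i j
    ...   | true = refl
    ...   | false = refl

  detℕ-specialised∅-square≉0 : ∀ n a A → Injective< n a → (∀ i → i < n → A i ≡ false) →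
                               ¬ (detℕ (n ℕ.+ n) (specialised n n a A) ≈ 0#)
  detℕ-specialised∅-square≉0 n a A a-inj A∅ det≈0 =
    sgn-≉0 (n ℕ.* n) _ (*-≉0 (detℕ-vandermonde≉0 n a a-inj) detWᵀ≉0)
      (trans (sym (detℕ-antiBlock n n (vandermonde a) W)) (trans (sym (detℕ-cong (n ℕ.+ n) blocks)) det≈0))
    where
    W : Matrix
    W x y = a y ^ x
    detWᵀ≉0 : ¬ (detℕ n W ≈ 0#)
    detWᵀ≉0 e = detℕ-vandermonde≉0 n a a-inj (trans (sym (detℕ-transpose n (vandermonde a))) e)
    blocks : ∀ i j → i < n ℕ.+ n → j < n ℕ.+ n → specialised n n a A i j ≈ antiBlock n n (vandermonde a) W i j
    blocks i j _ _ with i ℕP.<? n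
    ... | yes p rewrite ltb-true p | A∅ i p with ltb j n
    ...   | false = refl
    ...   | true with eqb i j
    ...     | true = refl
    ...     | false = refl
    blocks i j _ _ | no p rewrite ltb-false (ℕP.≮⇒≥ p) = refl

  -- Deleting the unit rows of A leaves the case A = ∅ with n − |A| top rows.
  detℕ-specialised≉0⇔ : ∀ n r a A → Injective< n a →
    (¬ (detℕ (n ℕ.+ r) (specialised n r a A) ≈ 0#)) ⇔ (count< n (λ i → not (A i)) ≡ r)
  detℕ-specialised≉0⇔ n r a A a-inj with findTrue n A
  detℕ-specialised≉0⇔ (suc n) r a A a-inj | inj₁ (i , i<n , Ai) =
    mk⇔ (λ det≉0 → P.trans count≡ (Equivalence.to ih
        (λ e → det≉0 (trans deleteRow (trans (sgn-cong (i ℕ.+ i) e) (sgn-0# (i ℕ.+ i)))))))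
        (λ count≡r e → Equivalence.from ih (P.trans (P.sym count≡) count≡r) (sgn≈0⇒≈0 (i ℕ.+ i) _ (trans (sym deleteRow) e)))
    where
    a' : ℕ → Carrier
    a' z = a (punchInℕ i z)
    A' : ℕ → Bool
    A' z = A (punchInℕ i z)
    ih : (¬ (detℕ (n ℕ.+ r) (specialised n r a' A') ≈ 0#)) ⇔ (count< n (λ z → not (A' z)) ≡ r)
    ih = detℕ-specialised≉0⇔ n r a' A'
           (λ x y px py e → punchInℕ-injective i x y (a-inj _ _ (punchInℕ-< i x px) (punchInℕ-< i y py) e))
    deleteRow : detℕ (suc n ℕ.+ r) (specialised (suc n) r a A) ≈ sgn (i ℕ.+ i) (detℕ (n ℕ.+ r) (specialised n r a' A'))
    deleteRow = detℕ-specialised-deleteUnitRow n r a A i i<n Ai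
    count≡ : count< (suc n) (λ z → not (A z)) ≡ count< n (λ z → not (A' z))
    count≡ = P.trans (count<-extract n i (ℕP.≤-pred i<n) (λ z → not (A z)))
                     (P.cong (λ b → boolToℕ (not b) ℕ.+ count< n (λ z → not (A' z))) Ai)
  detℕ-specialised≉0⇔ n r a A a-inj | inj₂ A∅ =
    mk⇔ (λ det≉0 → P.trans count≡n (n≡r det≉0)) (λ count≡r → square (P.trans (P.sym count≡n) count≡r))
    where
    count≡n : count< n (λ i → not (A i)) ≡ n
    count≡n = count<-all n _ (λ i p → P.cong not (A∅ i p))
    n≡r : ¬ (detℕ (n ℕ.+ r) (specialised n r a A) ≈ 0#) → n ≡ r
    n≡r det≉0 with n ℕ.≟ r
    ... | yes n≡r = n≡r
    ... | no n≢r = ⊥-elim (det≉0 (detℕ-specialised∅-nonsquare n r a A A∅ n≢r))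
    square : n ≡ r → ¬ (detℕ (n ℕ.+ r) (specialised n r a A) ≈ 0#)
    square P.refl = detℕ-specialised∅-square≉0 n a A a-inj A∅

  extendℕ : ∀ {n} → (Fin n → Carrier) → ℕ → Carrier
  extendℕ {zero} f x = 0#
  extendℕ {suc n} f zero = f Fin.zero
  extendℕ {suc n} f (suc x) = extendℕ (λ i → f (Fin.suc i)) x

  extendℕ-toℕ : ∀ {n} (f : Fin n → Carrier) i → extendℕ f (toℕ i) ≡ f i
  extendℕ-toℕ f Fin.zero = P.refl
  extendℕ-toℕ f (Fin.suc i) = extendℕ-toℕ (λ j → f (Fin.suc j)) i

  extendℕ-injective : ∀ {n} (f : Fin n → Carrier) → (∀ i j → f i ≈ f j → i ≡ j) → Injective< n (extendℕ f)
  extendℕ-injective f f-inj x y x<n y<n e =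
    P.trans (P.sym (FP.toℕ-fromℕ< x<n)) (P.trans (P.cong toℕ (f-inj _ _ e')) (FP.toℕ-fromℕ< y<n))
    where
    extendℕ-fromℕ< : ∀ z (z<n : z < _) → f (Fin.fromℕ< z<n) ≡ extendℕ f z
    extendℕ-fromℕ< z z<n = P.trans (P.sym (extendℕ-toℕ f _)) (P.cong (extendℕ f) (FP.toℕ-fromℕ< z<n))
    e' : f (Fin.fromℕ< x<n) ≈ f (Fin.fromℕ< y<n)
    e' = trans (reflexive (extendℕ-fromℕ< x x<n)) (trans e (reflexive (P.sym (extendℕ-fromℕ< y y<n))))

  -- The variable xₓ if x < n, and junk otherwise.
  varℕ : ∀ {n} → ℕ → Entry n
  varℕ {zero} x = cst 0#
  varℕ {suc n} zero = var Fin.zero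
  varℕ {suc n} (suc x) with varℕ {n} x
  ... | var i = var (Fin.suc i)
  ... | cst a = cst a

  varℕ-toℕ : ∀ {n} (i : Fin n) → varℕ (toℕ i) ≡ var i
  varℕ-toℕ Fin.zero = P.refl
  varℕ-toℕ (Fin.suc i) rewrite varℕ-toℕ i = P.refl

  varℕ-var : ∀ {n} x (i : Fin n) → varℕ x ≡ var i → toℕ i ≡ x
  varℕ-var {suc n} zero Fin.zero e = P.refl
  varℕ-var {suc n} (suc x) i e with varℕ {n} x in ex
  varℕ-var {suc n} (suc x) (Fin.suc i) P.refl | var .i = P.cong suc (varℕ-var x i ex)

  varℕ-< : ∀ {n} x → x < n → Σ (Fin n) λ i → varℕ x ≡ var i
  varℕ-< x p = Fin.fromℕ< p , P.trans (P.cong varℕ (P.sym (FP.toℕ-fromℕ< p))) (varℕ-toℕ _)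

  module ReadOnceMatrix (n r : ℕ) (a : ℕ → Carrier) where

    entryℕ : ℕ → ℕ → Entry n
    entryℕ x y = if ltb x n then (if ltb y n then (if eqb x y then varℕ x else cst 0#) else cst (a x ^ (y ∸ n)))
                 else (if ltb y n then cst (a y ^ (x ∸ n)) else cst 0#)

    M : Fin (n ℕ.+ r) → Fin (n ℕ.+ r) → Entry n
    M i j = entryℕ (toℕ i) (toℕ j)

    varOnDiagonal : ∀ x y (i : Fin n) → entryℕ x y ≡ var i → (toℕ i ≡ x) × (y ≡ x)
    varOnDiagonal x y i e with ltb x n | ltb y n | eqb x y in exy
    ... | true | true | true = varℕ-var x i e , P.sym (eqb⇒≡ exy)
    ... | true | true | false = ⊥-elim (cst≢var e)
    ... | true | false | _ = ⊥-elim (cst≢var e)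
    ... | false | true | _ = ⊥-elim (cst≢var e)
    ... | false | false | _ = ⊥-elim (cst≢var e)

    M-readOnce : ReadOnce M
    M-readOnce _ _ _ _ i e e' with varOnDiagonal _ _ i e | varOnDiagonal _ _ i e'
    ... | p , q | p' , q' =
      FP.toℕ-injective (P.trans (P.sym p) p') ,
      FP.toℕ-injective (P.trans q (P.trans (P.sym p) (P.trans p' (P.sym q'))))

    M-oneVarPerRow : OneVarPerRow M
    M-oneVarPerRow _ _ _ i i' e e' =
      FP.toℕ-injective (P.trans (proj₂ (varOnDiagonal _ _ i e)) (P.sym (proj₂ (varOnDiagonal _ _ i' e'))))

    M-oneVarPerCol : OneVarPerCol M
    M-oneVarPerCol _ _ _ i i' e e' =
      FP.toℕ-injective (P.trans (P.sym (proj₂ (varOnDiagonal _ _ i e))) (proj₂ (varOnDiagonal _ _ i' e')))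

    M-contains : ∀ (i : Fin n) → Σ (Fin (n ℕ.+ r)) λ x → Σ (Fin (n ℕ.+ r)) λ y → M x y ≡ var i
    M-contains i = i ↑ˡ r , i ↑ˡ r , diagonal
      where
      diagonal : entryℕ (toℕ (i ↑ˡ r)) (toℕ (i ↑ˡ r)) ≡ var i
      diagonal rewrite FP.toℕ-↑ˡ i r | ltb-true (FP.toℕ<n i) | eqb-refl (toℕ i) = varℕ-toℕ i

    rowHit-M : ∀ (m : Monomial n) x → rowHit m M x ≡ (if ltb (toℕ x) n then ltb 0 (lookupℕ m (toℕ x)) else false)
    rowHit-M m x = byRow (ltb (toℕ x) n) P.refl
      where
      byRow : ∀ b → ltb (toℕ x) n ≡ b → rowHit m M x ≡ (if b then ltb 0 (lookupℕ m (toℕ x)) else false)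
      byRow false ex = anyᶠ-false _ constantRow
        where
        constantRow : ∀ (y : Fin (n ℕ.+ r)) → hits m (entryℕ (toℕ x) (toℕ y)) ≡ false
        constantRow y rewrite ex with ltb (toℕ y) n
        ... | true = P.refl
        ... | false = P.refl
      byRow true ex with varℕ-< {n} (toℕ x) (ltb⇒< ex)
      ... | i , ei = P.trans (anyᶠ-only _ x offDiagonal) diagonal
        where
        offDiagonal : ∀ (y : Fin (n ℕ.+ r)) → y ≢ x → hits m (entryℕ (toℕ x) (toℕ y)) ≡ false
        offDiagonal y y≢x rewrite ex with ltb (toℕ y) n
        ... | false = P.refl
        ... | true rewrite eqb-false {toℕ x} {toℕ y} (λ e → y≢x (FP.toℕ-injective (P.sym e))) = P.refl
        diagonal : hits m (entryℕ (toℕ x) (toℕ x)) ≡ ltb 0 (lookupℕ m (toℕ x))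
        diagonal rewrite ex | eqb-refl (toℕ x) | ei =
          P.cong (ltb 0) (P.trans (P.sym (lookupℕ-toℕ m i)) (P.cong (lookupℕ m) (varℕ-var (toℕ x) i ei)))

    specialise-M : ∀ (m : Monomial n) → Squarefree m → ∀ x y →
                   specialise m M x y ≈ specialised n r a (support m) (toℕ x) (toℕ y)
    specialise-M m m-sqf x y rewrite rowHit-M m x with ltb (toℕ x) n in ex | ltb (toℕ y) n
    ... | false | true = refl
    ... | false | false = refl
    ... | true | false = reflexive (P.cong (λ b → if b then 0# else a (toℕ x) ^ (toℕ y ∸ n)) (ltb0≡eqb1 m-x≤1))
      where
      m-x≤1 : lookupℕ m (toℕ x) ≤ 1
      m-x≤1 = P.subst (_≤ 1) (P.trans (P.sym (lookupℕ-toℕ m _)) (P.cong (lookupℕ m) (FP.toℕ-fromℕ< (ltb⇒< ex)))) (m-sqf _)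
    ... | true | true with eqb (toℕ x) (toℕ y)
    ...   | false = if-same (ltb 0 (lookupℕ m (toℕ x)))
      where
      if-same : ∀ b → (if b then 0# else 0#) ≈ 0#
      if-same true = refl
      if-same false = refl
    ...   | true with varℕ-< {n} (toℕ x) (ltb⇒< ex)
    ...     | i , ei rewrite ei = reflexive (P.cong (λ v → if eqb v 1 then 1# else 0#)
                                    (P.trans (P.sym (lookupℕ-toℕ m i)) (P.cong (lookupℕ m) (varℕ-var (toℕ x) i ei))))

    coeff-M≉0⇔ : Injective< n a → ∀ (m : Monomial n) → Squarefree m →
                 (m ∈mon det (λ x y → ⟦ M x y ⟧)) ⇔ (count< n (λ i → not (support m i)) ≡ r)
    coeff-M≉0⇔ a-inj m m-sqf =
      mk⇔ (λ m∈ → Equivalence.to spec (λ e → m∈ (trans coeff≈ e)))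
          (λ count≡ e → Equivalence.from spec count≡ (trans (sym coeff≈) e))
      where
      spec : (¬ (detℕ (n ℕ.+ r) (specialised n r a (support m)) ≈ 0#)) ⇔ (count< n (λ i → not (support m i)) ≡ r)
      spec = detℕ-specialised≉0⇔ n r a (support m) a-inj
      coeff≈ : det (λ x y → ⟦ M x y ⟧) m ≈ detℕ (n ℕ.+ r) (specialised n r a (support m))
      coeff≈ = trans (det-coeff M m) (detCoeff-squarefree (n ℕ.+ r) M m _ spec' (specialise-M m m-sqf))
        where
        spec' : Specialisable M m
        spec' = record { readOnce = M-readOnce ; oneVarPerRow = M-oneVarPerRow ; oneVarPerCol = M-oneVarPerCol
                       ; squarefree = m-sqf ; contains = λ i _ → M-contains i }

    coeff-M-nonSquarefree : ∀ (m : Monomial n) (i : Fin n) → 2 ≤ lookup m i → det (λ x y → ⟦ M x y ⟧) m ≈ 0#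
    coeff-M-nonSquarefree m i m-i≥2 = trans (det-coeff M m) (detCoeff-nonSquarefree M m i M-readOnce m-i≥2)

theorem3 : ∀ {c ℓ} (F : Field c ℓ) (n d : ℕ) → 1 ≤ d → d ≤ n →
    (Σ (Fin n → Field.Carrier F) λ f → ∀ i j → Field._≈_ F (f i) (f j) → i ≡ j) →
    let open PolyRing F in
    Σ ℕ λ k → Σ (Fin k → Fin k → Entry n) λ M →
    ReadOnce M × (∀ (m : Monomial n) → (m ∈mon det (λ r s → ⟦ M r s ⟧)) ⇔ (m ∈mon S n d))
theorem3 F n d _ d≤n (f , f-inj) = n ℕ.+ (n ∸ d) , M , M-readOnce , sameMonomials
  where
  open PolyRing F
  open Coefficients F
  open Construction F
  open ReadOnceMatrix n (n ∸ d) (extendℕ f)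
  sameMonomials : ∀ (m : Monomial n) → (m ∈mon det (λ r s → ⟦ M r s ⟧)) ⇔ (m ∈mon S n d)
  sameMonomials m with squarefree? m
  ... | inj₁ (i , m-i≥2) =
    mk⇔ (λ m∈ → ⊥-elim (m∈ (coeff-M-nonSquarefree m i m-i≥2)))
        (λ m∈ → ⊥-elim (m∈ (S-coeff-nonSquarefree n d m i m-i≥2)))
  ... | inj₂ m-sqf =
    ⇔.trans (coeff-M≉0⇔ (extendℕ-injective f f-inj) m m-sqf)
            (⇔.trans (complement≡n∸d⇔weight≡d d m d≤n) (⇔.sym (S-coeff≉0⇔ n d m m-sqf)))
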